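{- Let $\lambda$ be a strict partition and let $n$ be a positive integer. Let $\Delta=(\Delta_1,\dots,\Delta_\ell)$ (with $\Delta_\ell>0$) be the largest D-partition contained in $\lambda$. Then the degree (in $x_1,\dots,x_n$) of the $P$-Grothendieck polynomial $GP_{\lambda,n}$ is \[ \deg(GP_{\lambda,n}) = \begin{cases} |\Delta| + 2n\ell-\ell^2-\ell, & \text{if } \Delta_\ell > 1; \\ |\Delta|+2n\ell-\ell^2-n, & \text{if } \Delta_\ell = 1. \end{cases} \]
   Context: A strict partition is $\lambda=(\lambda_1>\lambda_2>\dots>\lambda_m>0)$; $|\lambda|=\sum\lambda_i$ and $\ell(\lambda)=m$. A D-partition is a partition whose consecutive parts satisfy $\lambda_{i-1}-\lambda_i\ge 2$ for all $i$; containment of partitions means $\mu_i\le\lambda_i$ for all $i$, and "the largest D-partition contained in $\lambda$" is the D-partition $\Delta\subseteq\lambda$ of maximal size. The shifted diagram of a strict partition $\lambda$ has, for each $i$, a row $i$ consisting of the boxes $(i,j)$ with $i\le j\le i+\lambda_i-1$; rows are drawn in French convention (row 1 at the bottom), so the box above $(i,j)$ is $(i+1,j)$ and the box to the right of $(i,j)$ is $(i,j+1)$. The main diagonal consists of the boxes $(i,i)$. Let $\mathbb{S}$ be the totally ordered alphabet $1'<1<2'<2<3'<3<\cdots$. A $P$-shifted set-valued tableau of shape $\lambda$ is an assignment $T$ of a nonempty finite subset $T(\mathsf{B})\subseteq\mathbb{S}$ to each box $\mathsf{B}$ of the shifted diagram such that for every box $\mathsf{B}$, writing $\mathsf{B}^\uparrow,\mathsf{B}^\rightarrow$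 for the boxes above and to the right (conditions imposed only when these boxes exist): if $\max T(\mathsf{B})$ is primed then $\max T(\mathsf{B})\le\min T(\mathsf{B}^\uparrow)$ and $\max T(\mathsf{B})<\min T(\mathsf{B}^\rightarrow)$; if $\max T(\mathsf{B})$ is unprimed then $\max T(\mathsf{B})<\min T(\mathsf{B}^\uparrow)$ and $\max T(\mathsf{B})\le\min T(\mathsf{B}^\rightarrow)$; and no box on the main diagonal contains a primed entry. $\mathrm{PSVT}(\lambda,n)$ denotes the set of such tableaux with all entries in $\{1',1,\dots,n',n\}$. The content $c(T)=(c_1,c_2,\dots)$ has $c_i$ equal to the number of entries of $T$ (over all boxes) equal to $i$ or $i'$; the degree is $d(T)=\sum_i c_i$. The $P$-Grothendieck polynomial is $GP_{\lambda,n}=\sum_{T\in\mathrm{PSVT}(\lambda,n)}\beta^{d(T)-|\lambda|}\mathbf{x}^{c(T)}$, where $\beta$ is a fixed nonzero scalar (e.g. $\beta=-1$) and $\mathbf{x}^{c}=\prod_i x_i^{c_i}$. -}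

module Defs where

open import Data.Nat using (ℕ; zero; suc; _+_; _*_; _≤_; _<_)
open import Data.Bool using (Bool; true; false)
open import Data.Integer as ℤ using (ℤ; +_)
open import Data.List using (List; []; _∷_; length; head; last)
open import Data.Nat.ListAction using (sum)
open import Data.List.Relation.Unary.All using (All)
open import Data.List.Relation.Unary.Linked using (Linked)
open import Data.Maybe using (Maybe; just; nothing)
open import Data.Product using (_×_; ∃)
open import Data.Unit using (⊤)
open import Data.Empty using (⊥)
open import Relation.Nullary using (¬_)
open import Relation.Binary.PropositionalEquality using (_≡_)

-- Partitions (as lists of parts, largest first)

-- λ_i (1-indexed), with λ_i = 0 for i = 0 or i > ℓ(λ)
part : List ℕ → ℕ → ℕ
part []       _             = 0
part (_ ∷ _)  zero          = 0
part (x ∷ _)  (suc zero)    = x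
part (_ ∷ xs) (suc (suc i)) = part xs (suc i)

size : List ℕ → ℕ
size = sum

len : List ℕ → ℕ
len = length

StrictPartition : List ℕ → Set
StrictPartition la = All (λ x → 0 < x) la × Linked (λ a b → b < a) la

DPartition : List ℕ → Set
DPartition la = All (λ x → 0 < x) la × Linked (λ a b → b + 2 ≤ a) la

_⊆P_ : List ℕ → List ℕ → Set
mu ⊆P la = ∀ i → part mu i ≤ part la i

IsLargestDPartitionIn : List ℕ → List ℕ → Set
IsLargestDPartitionIn Δ la =
  DPartition Δ × Δ ⊆P la × (∀ mu → DPartition mu → mu ⊆P la → size mu ≤ size Δ)

-- The alphabet 𝕊 = 1' < 1 < 2' < 2 < ...

data Letter : Set where
  primed   : ℕ → Letter
  unprimed : ℕ → Letter

idx : Letter → ℕ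
idx (primed k)   = k
idx (unprimed k) = k

code : Letter → ℕ
code (primed k)   = 2 * k
code (unprimed k) = suc (2 * k)

_<L_ : Letter → Letter → Set
a <L b = code a < code b

_≤L_ : Letter → Letter → Set
a ≤L b = code a ≤ code b

isPrimed : Letter → Bool
isPrimed (primed _)   = true
isPrimed (unprimed _) = false

-- Shifted diagrams: box (i,j), 1-indexed, with i ≤ j ≤ i + λ_i - 1

InD : List ℕ → ℕ → ℕ → Set
InD la i j = 1 ≤ i × i ≤ j × j < i + part la i

-- a box filling: a finite nonempty subset of 𝕊, given as a strictly
-- increasing nonempty list (so min = head, max = last)
Filling : Set
Filling = List Letter

ValidSet : ℕ → Filling → Set
ValidSet n S = ¬ (S ≡ []) × Linked _<L_ S × All (λ x → 1 ≤ idx x × idx x ≤ n) S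

-- condition between max T(B) and min T(B↑)
UpOK : Maybe Letter → Maybe Letter → Set
UpOK (just m) (just a) with isPrimed m
... | true  = m ≤L a
... | false = m <L a
UpOK _ _ = ⊥

-- condition between max T(B) and min T(B→)
RightOK : Maybe Letter → Maybe Letter → Set
RightOK (just m) (just a) with isPrimed m
... | true  = m <L a
... | false = m ≤L a
RightOK _ _ = ⊥

-- T is a P-shifted set-valued tableau of shape λ with entries in {1',1,…,n',n}
-- (T is a filling of all positions; only boxes of the diagram matter)
IsPSVT : List ℕ → ℕ → (ℕ → ℕ → Filling) → Set
IsPSVT la n T =
  (∀ i j → InD la i j → ValidSet n (T i j))
  × (∀ i j → InD la i j → InD la (suc i) j → UpOK (last (T i j)) (head (T (suc i) j)))
  × (∀ i j → InD la i j → InD la i (suc j) → RightOK (last (T i j)) (head (T i (suc j))))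
  × (∀ i → InD la i i → All (λ x → isPrimed x ≡ false) (T i i))

-- degree d(T) = Σ_i c_i(T) = total number of entries over all boxes

rowEntries : (ℕ → ℕ → Filling) → ℕ → ℕ → ℕ → ℕ
rowEntries T i j zero    = 0
rowEntries T i j (suc k) = length (T i j) + rowEntries T i (suc j) k

entriesFrom : (ℕ → ℕ → Filling) → ℕ → List ℕ → ℕ
entriesFrom T i []       = 0
entriesFrom T i (x ∷ xs) = rowEntries T i i x + entriesFrom T (suc i) xs

degT : List ℕ → (ℕ → ℕ → Filling) → ℕ
degT la T = entriesFrom T 1 la

-- "deg GP_{λ,n} = D": every tableau has degree ≤ D and some tableau attains D
-- (no cancellation)
HasDegree : List ℕ → ℕ → ℤ → Set
HasDegree la n D =
  (∀ T → IsPSVT la n T → + degT la T ℤ.≤ D)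
  × ∃ (λ T → IsPSVT la n T × + degT la T ≡ D)

degFormula : ℕ → List ℕ → ℤ
degFormula n Δ with last Δ
... | just 1 = + size Δ ℤ.+ + (2 * n * ℓ) ℤ.- + (ℓ * ℓ) ℤ.- + n
  where ℓ = len Δ
... | _      = + size Δ ℤ.+ + (2 * n * ℓ) ℤ.- + (ℓ * ℓ) ℤ.- + ℓ
  where ℓ = len Δ

module Submission where

-- Order the alphabet by the codes k′ ↦ 2k, k ↦ 2k+1.  Give each box B of a tableau the slack
-- 2n+1 − code(max B), split into a right part n − idx(max B) and an upper part
-- n − idx(max B) + [max B primed]; on the diagonal only the right part counts.  A box outside Δ
-- holds at most (right part of its left neighbour) + (upper part of its lower neighbour) − slack,
-- while the δ_r boxes of row r inside Δ, whose codes run from 2r+1 to 2n+1, hold at most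
-- b_r = 2n + δ_r − 2r entries plus the slack they pass on (n + 1 − r if δ_r = 1).  Summed over
-- the rows, all slack cancels, so deg T ≤ Σ_r b_r, which is the formula.  The cancellation
-- needs the boxes of row r+1 outside Δ to lie above boxes of row r from its last Δ-box on,
-- and this is exactly what maximality of Δ gives: δ_1 = λ_1, δ_r ≤ δ_{r+1} + 2 when row r+1
-- of λ is longer than that of Δ, and δ_ℓ ≤ 2 when ℓ < ℓ(λ).
-- Equality holds for the tableau with r in the Δ-boxes of row r, a full interval of letters in
-- the last of them, and in every other box the single letter of index n − κ, where κ is the
-- length of the diagonal run of boxes above-right of it, primed iff that run ends below a box:
-- there every local inequality is an equality.

open import Defs
open import Data.Nat using (ℕ; _≤_; _<_)
open import Data.List using (List; [])
open import Relation.Nullary using (¬_)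
open import Relation.Binary.PropositionalEquality using (_≡_)

open import Data.Nat
open import Data.Nat.Properties
open import Data.Nat.ListAction using (sum)
open import Data.Nat.Tactic.RingSolver using (solve-∀)
open import Data.Bool using (false)
open import Data.Empty using (⊥; ⊥-elim)
open import Data.Integer as ℤ using (ℤ)
import Data.Integer.Tactic.RingSolver as ℤ-Solver
open import Data.List using (_∷_; length; last; head; _++_; [_])
open import Data.List.Relation.Unary.All using (All; []; _∷_) renaming (map to All-map)
open import Data.List.Relation.Unary.Linked using (Linked; []; [-]; _∷_)
open import Data.Maybe using (just)
open import Data.Product using (Σ; _×_; _,_; proj₁; proj₂)
open import Data.Sum using (_⊎_; inj₁; inj₂)
open import Function using (_∘_)
open import Relation.Binary.PropositionalEquality hiding ([_]; isPreorder)
open import Relation.Binary.Definitions using (tri<; tri≈; tri>)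
open import Relation.Binary.Bundles using (Preorder)
open import Relation.Binary.Structures using (IsPreorder)
import Relation.Binary.Reasoning.Preorder
open import Relation.Binary.PropositionalEquality.Properties using () renaming (isPreorder to ≡-isPreorder)
open import Relation.Nullary using (Dec; yes; no)
open import Relation.Nullary.Decidable using (_×-dec_)
open import Algebra.Properties.CommutativeSemigroup +-commutativeSemigroup using (interchange)

sumRange : (ℕ → ℕ) → ℕ → ℕ → ℕ
sumRange f a zero    = 0
sumRange f a (suc k) = f a + sumRange f (suc a) k

InRange : ℕ → ℕ → ℕ → Set
InRange a k j = a ≤ j × j < a + k

InRange-head : ∀ a k → InRange a (suc k) a
InRange-head a k = ≤-refl , m<m+n a z<s

InRange-tail : ∀ {a k j} → InRange (suc a) k j → InRange a (suc k) j
InRange-tail {a} {k} {j} (a<j , j<) = <⇒≤ a<j , subst (j <_) (sym (+-suc a k)) j<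

sumRange-cong : ∀ {f g} a k → (∀ j → InRange a k j → f j ≡ g j) → sumRange f a k ≡ sumRange g a k
sumRange-cong a zero    f≡g = refl
sumRange-cong a (suc k) f≡g =
  cong₂ _+_ (f≡g a (InRange-head a k)) (sumRange-cong (suc a) k (λ j r → f≡g j (InRange-tail r)))

sumRange-+ : ∀ f g a k → sumRange (λ j → f j + g j) a k ≡ sumRange f a k + sumRange g a k
sumRange-+ f g a zero    = refl
sumRange-+ f g a (suc k) rewrite sumRange-+ f g (suc a) k =
  interchange (f a) (g a) (sumRange f (suc a) k) (sumRange g (suc a) k)

sumRange-split : ∀ f a k m → sumRange f a (k + m) ≡ sumRange f a k + sumRange f (a + k) m
sumRange-split f a zero    m rewrite +-identityʳ a = refl
sumRange-split f a (suc k) m rewrite sumRange-split f (suc a) k m | +-suc a k =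
  sym (+-assoc (f a) (sumRange f (suc a) k) (sumRange f (suc (a + k)) m))

sumRange-last : ∀ f a k → sumRange f a (suc k) ≡ sumRange f a k + f (a + k)
sumRange-last f a k = begin
  sumRange f a (suc k)                 ≡⟨ cong (sumRange f a) (+-comm 1 k) ⟩
  sumRange f a (k + 1)                 ≡⟨ sumRange-split f a k 1 ⟩
  sumRange f a k + (f (a + k) + 0)     ≡⟨ cong (sumRange f a k +_) (+-identityʳ (f (a + k))) ⟩
  sumRange f a k + f (a + k)           ∎
  where open ≡-Reasoning

sumRange-suc : ∀ f a k → sumRange f (suc a) k ≡ sumRange (λ j → f (suc j)) a k
sumRange-suc f a zero    = refl
sumRange-suc f a (suc k) = cong (f (suc a) +_) (sumRange-suc f (suc a) k)

sumRange-const0 : ∀ a k → sumRange (λ _ → 0) a k ≡ 0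
sumRange-const0 a zero    = refl
sumRange-const0 a (suc k) = sumRange-const0 (suc a) k

sumRange-zero : ∀ f a k → (∀ j → InRange a k j → f j ≡ 0) → sumRange f a k ≡ 0
sumRange-zero f a k f≡0 = trans (sumRange-cong a k f≡0) (sumRange-const0 a k)

part-zero : ∀ xs → part xs 0 ≡ 0
part-zero []      = refl
part-zero (_ ∷ _) = refl

part-beyond : ∀ xs {i} → length xs < i → part xs i ≡ 0
part-beyond []       _             = refl
part-beyond (x ∷ xs) {suc (suc i)} (s≤s h) = part-beyond xs h

part-cons : ∀ x xs {i} → 1 ≤ i → part (x ∷ xs) (suc i) ≡ part xs i
part-cons x xs {suc i} _ = refl

Linked⇒part : ∀ {R : ℕ → ℕ → Set} xs → Linked R xs →
              ∀ i → suc (suc i) ≤ length xs → R (part xs (suc i)) (part xs (suc (suc i)))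
Linked⇒part (x ∷ y ∷ ys) (r ∷ _) zero    _       = r
Linked⇒part (x ∷ y ∷ ys) (_ ∷ l) (suc i) (s≤s h) = Linked⇒part (y ∷ ys) l i h
Linked⇒part (x ∷ [])     [-]     i       (s≤s ())

part⇒Linked : ∀ {R : ℕ → ℕ → Set} xs →
              (∀ i → suc (suc i) ≤ length xs → R (part xs (suc i)) (part xs (suc (suc i)))) → Linked R xs
part⇒Linked []           _ = []
part⇒Linked (x ∷ [])     _ = [-]
part⇒Linked (x ∷ y ∷ ys) h = h zero (s≤s (s≤s z≤n)) ∷ part⇒Linked (y ∷ ys) (λ i q → h (suc i) (s≤s q))

All⇒part : ∀ {P : ℕ → Set} xs → All P xs → ∀ i → suc i ≤ length xs → P (part xs (suc i))
All⇒part (x ∷ xs)     (p ∷ _)  zero    _       = p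
All⇒part (x ∷ y ∷ xs) (_ ∷ ps) (suc i) (s≤s h) = All⇒part (y ∷ xs) ps i h
All⇒part (x ∷ [])     _        (suc i) (s≤s ())

part⇒All : ∀ {P : ℕ → Set} xs → (∀ i → suc i ≤ length xs → P (part xs (suc i))) → All P xs
part⇒All []           _ = []
part⇒All (x ∷ [])     h = h zero (s≤s z≤n) ∷ []
part⇒All (x ∷ y ∷ xs) h = h zero (s≤s z≤n) ∷ part⇒All (y ∷ xs) (λ i q → h (suc i) (s≤s q))

sum≡sumRange-part : ∀ xs → sum xs ≡ sumRange (part xs) 1 (length xs)
sum≡sumRange-part []       = refl
sum≡sumRange-part (x ∷ xs) = cong (x +_) (begin
  sum xs                                              ≡⟨ sum≡sumRange-part xs ⟩
  sumRange (part xs) 1 (length xs)                    ≡⟨ sumRange-cong 1 (length xs) (λ j r → sym (part-cons x xs (proj₁ r))) ⟩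
  sumRange (λ j → part (x ∷ xs) (suc j)) 1 (length xs) ≡⟨ sumRange-suc (part (x ∷ xs)) 1 (length xs) ⟨
  sumRange (part (x ∷ xs)) 2 (length xs)              ∎)
  where open ≡-Reasoning

1≤length : ∀ {A : Set} (xs : List A) → xs ≢ [] → 1 ≤ length xs
1≤length []      ne = ⊥-elim (ne refl)
1≤length (_ ∷ _) _  = s≤s z≤n

last≡part-length : ∀ xs → 1 ≤ length xs → last xs ≡ just (part xs (length xs))
last≡part-length (x ∷ [])     _ = refl
last≡part-length (x ∷ y ∷ ys) _ = last≡part-length (y ∷ ys) (s≤s z≤n)

incrementPart : List ℕ → ℕ → List ℕ
incrementPart []       _             = []
incrementPart (x ∷ xs) zero          = x ∷ xs
incrementPart (x ∷ xs) (suc zero)    = suc x ∷ xs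
incrementPart (x ∷ xs) (suc (suc i)) = x ∷ incrementPart xs (suc i)

length-incrementPart : ∀ xs i → length (incrementPart xs i) ≡ length xs
length-incrementPart []       i             = refl
length-incrementPart (x ∷ xs) zero          = refl
length-incrementPart (x ∷ xs) (suc zero)    = refl
length-incrementPart (x ∷ xs) (suc (suc i)) = cong suc (length-incrementPart xs (suc i))

sum-incrementPart : ∀ xs i → suc i ≤ length xs → sum (incrementPart xs (suc i)) ≡ suc (sum xs)
sum-incrementPart (x ∷ xs) zero    _       = refl
sum-incrementPart (x ∷ xs) (suc i) (s≤s h) = trans (cong (x +_) (sum-incrementPart xs i h)) (+-suc x (sum xs))

part-incrementPart-same : ∀ xs i → suc i ≤ length xs → part (incrementPart xs (suc i)) (suc i) ≡ suc (part xs (suc i))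
part-incrementPart-same (x ∷ xs) zero    _       = refl
part-incrementPart-same (x ∷ xs) (suc i) (s≤s h) = part-incrementPart-same xs i h

part-incrementPart-other : ∀ xs i j → j ≢ i → part (incrementPart xs (suc i)) (suc j) ≡ part xs (suc j)
part-incrementPart-other []       i       j       _  = refl
part-incrementPart-other (x ∷ xs) zero    zero    ne = ⊥-elim (ne refl)
part-incrementPart-other (x ∷ xs) zero    (suc j) _  = refl
part-incrementPart-other (x ∷ xs) (suc i) zero    _  = refl
part-incrementPart-other (x ∷ xs) (suc i) (suc j) ne = part-incrementPart-other xs i j (ne ∘ cong suc)

part-incrementPart-zero : ∀ xs i → part (incrementPart xs (suc i)) 0 ≡ 0
part-incrementPart-zero xs i = part-zero (incrementPart xs (suc i))

length-snoc1 : ∀ xs → length (xs ++ [ 1 ]) ≡ suc (length xs)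
length-snoc1 []       = refl
length-snoc1 (x ∷ xs) = cong suc (length-snoc1 xs)

sum-snoc1 : ∀ xs → sum (xs ++ [ 1 ]) ≡ suc (sum xs)
sum-snoc1 []       = refl
sum-snoc1 (x ∷ xs) = trans (cong (x +_) (sum-snoc1 xs)) (+-suc x (sum xs))

part-snoc1-old : ∀ xs j → j ≤ length xs → part (xs ++ [ 1 ]) j ≡ part xs j
part-snoc1-old []           zero          _       = refl
part-snoc1-old (x ∷ xs)     zero          _       = refl
part-snoc1-old (x ∷ xs)     (suc zero)    _       = refl
part-snoc1-old (x ∷ y ∷ xs) (suc (suc j)) (s≤s h) = part-snoc1-old (y ∷ xs) (suc j) h

part-snoc1-new : ∀ xs → part (xs ++ [ 1 ]) (suc (length xs)) ≡ 1
part-snoc1-new []           = refl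
part-snoc1-new (x ∷ [])     = refl
part-snoc1-new (x ∷ y ∷ xs) = part-snoc1-new (y ∷ xs)

-- First and last letter of a filling; for the strictly increasing fillings of a tableau
-- these are its least and greatest letter (the value at [] is junk).
minOf : List Letter → Letter
minOf []      = unprimed 0
minOf (x ∷ _) = x

maxOf : List Letter → Letter
maxOf []           = unprimed 0
maxOf (x ∷ [])     = x
maxOf (_ ∷ y ∷ ys) = maxOf (y ∷ ys)

head≡minOf : ∀ S → S ≢ [] → head S ≡ just (minOf S)
head≡minOf []      ne = ⊥-elim (ne refl)
head≡minOf (x ∷ S) _  = refl

last≡maxOf : ∀ S → S ≢ [] → last S ≡ just (maxOf S)
last≡maxOf []           ne = ⊥-elim (ne refl)
last≡maxOf (x ∷ [])     _  = refl
last≡maxOf (x ∷ y ∷ S) _  = last≡maxOf (y ∷ S) (λ ())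

minOf-head : ∀ S {a} → head S ≡ just a → minOf S ≡ a
minOf-head (x ∷ S) refl = refl

maxOf-last : ∀ S {a} → last S ≡ just a → maxOf S ≡ a
maxOf-last (x ∷ [])    refl = refl
maxOf-last (x ∷ y ∷ S) e    = maxOf-last (y ∷ S) e

All-minOf : ∀ {P : Letter → Set} S → All P S → S ≢ [] → P (minOf S)
All-minOf []      _       ne = ⊥-elim (ne refl)
All-minOf (x ∷ S) (p ∷ _) _  = p

All-maxOf : ∀ {P : Letter → Set} S → All P S → S ≢ [] → P (maxOf S)
All-maxOf []          _        ne = ⊥-elim (ne refl)
All-maxOf (x ∷ [])    (p ∷ _)  _  = p
All-maxOf (x ∷ y ∷ S) (_ ∷ ps) _  = All-maxOf (y ∷ S) ps (λ ())

primeBit : Letter → ℕ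
primeBit (primed _)   = 1
primeBit (unprimed _) = 0

-- The least code of a letter allowed directly above a box whose greatest letter is m.
upCode : Letter → ℕ
upCode (primed k)   = 2 * k
upCode (unprimed k) = 2 + 2 * k

code+primeBit : ∀ x → code x + primeBit x ≡ suc (2 * idx x)
code+primeBit (primed k)   = +-comm (2 * k) 1
code+primeBit (unprimed k) = cong suc (+-identityʳ (2 * k))

code-unprimed : ∀ x → isPrimed x ≡ false → code x ≡ suc (2 * idx x)
code-unprimed (unprimed k) _ = refl

2*idx≤code : ∀ x → 2 * idx x ≤ code x
2*idx≤code (primed k)   = ≤-refl
2*idx≤code (unprimed k) = n≤1+n _

code≤1+2*idx : ∀ x → code x ≤ suc (2 * idx x)
code≤1+2*idx (primed k)   = n≤1+n _
code≤1+2*idx (unprimed k) = ≤-refl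

2*[1+n] : ∀ n → 2 * suc n ≡ suc (suc (2 * n))
2*[1+n] = solve-∀

2*m≤1+2*n⇒m≤n : ∀ m n → 2 * m ≤ suc (2 * n) → m ≤ n
2*m≤1+2*n⇒m≤n m n h = ≤-pred (*-cancelˡ-< 2 m (suc n) (≤-<-trans h (≤-reflexive (sym (2*[1+n] n)))))

code≤⇒idx≤ : ∀ x y → code x ≤ code y → idx x ≤ idx y
code≤⇒idx≤ x y h = 2*m≤1+2*n⇒m≤n (idx x) (idx y) (≤-trans (2*idx≤code x) (≤-trans h (code≤1+2*idx y)))

UpOK⇒upCode≤ : ∀ m a → UpOK (just m) (just a) → upCode m ≤ code a
UpOK⇒upCode≤ (primed k)   a h = h
UpOK⇒upCode≤ (unprimed k) a h = h

upCode≤⇒UpOK : ∀ m a → upCode m ≤ code a → UpOK (just m) (just a)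
upCode≤⇒UpOK (primed k)   a h = h
upCode≤⇒UpOK (unprimed k) a h = h

RightOK⇒1+2*idx≤ : ∀ m a → RightOK (just m) (just a) → suc (2 * idx m) ≤ code a
RightOK⇒1+2*idx≤ (primed k)   a h = h
RightOK⇒1+2*idx≤ (unprimed k) a h = h

1+2*idx≤⇒RightOK : ∀ m a → suc (2 * idx m) ≤ code a → RightOK (just m) (just a)
1+2*idx≤⇒RightOK (primed k)   a h = h
1+2*idx≤⇒RightOK (unprimed k) a h = h

length+code≤ : ∀ S → Linked _<L_ S → S ≢ [] → length S + code (minOf S) ≤ code (maxOf S) + 1
length+code≤ []          _       ne = ⊥-elim (ne refl)
length+code≤ (x ∷ [])    _       _  = ≤-reflexive (+-comm 1 (code x))
length+code≤ (x ∷ y ∷ S) (r ∷ l) _  = begin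
  suc (length (y ∷ S)) + code x   ≡⟨ +-suc (length (y ∷ S)) (code x) ⟨
  length (y ∷ S) + suc (code x)   ≤⟨ +-monoʳ-≤ (length (y ∷ S)) r ⟩
  length (y ∷ S) + code y         ≤⟨ length+code≤ (y ∷ S) l (λ ()) ⟩
  code (maxOf (y ∷ S)) + 1        ∎
  where open ≤-Reasoning

length+idx≤ : ∀ S → Linked _<L_ S → All (λ x → isPrimed x ≡ false) S → S ≢ [] →
              length S + idx (minOf S) ≤ idx (maxOf S) + 1
length+idx≤ []          _       _        ne = ⊥-elim (ne refl)
length+idx≤ (x ∷ [])    _       _        _  = ≤-reflexive (+-comm 1 (idx x))
length+idx≤ (x ∷ y ∷ S) (r ∷ l) (px ∷ a) _  = begin
  suc (length (y ∷ S)) + idx x   ≡⟨ +-suc (length (y ∷ S)) (idx x) ⟨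
  length (y ∷ S) + suc (idx x)   ≤⟨ +-monoʳ-≤ (length (y ∷ S)) (unprimed-<L x y px (All-minOf (y ∷ S) a (λ ())) r) ⟩
  length (y ∷ S) + idx y         ≤⟨ length+idx≤ (y ∷ S) l a (λ ()) ⟩
  idx (maxOf (y ∷ S)) + 1        ∎
  where
  open ≤-Reasoning
  unprimed-<L : ∀ x y → isPrimed x ≡ false → isPrimed y ≡ false → x <L y → idx x < idx y
  unprimed-<L (unprimed a) (unprimed b) _ _ (s≤s h) = *-cancelˡ-< 2 a b h

upCode+2*primeBit : ∀ m → upCode m + 2 * primeBit m ≡ 2 + 2 * idx m
upCode+2*primeBit (primed k)   = +-comm (2 * k) 2
upCode+2*primeBit (unprimed k) = +-identityʳ (2 + 2 * k)

2*[1+n]≤upCode : ∀ n m → suc (2 * n) ≤ code m → 2 * suc n ≤ upCode m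
2*[1+n]≤upCode n (primed b)   h       = *-monoʳ-≤ 2 (2*m≤1+2*n⇒m≤n (suc n) b (subst (_≤ suc (2 * b)) (sym (2*[1+n] n)) (s≤s h)))
2*[1+n]≤upCode n (unprimed b) (s≤s h) = subst (_≤ 2 + 2 * b) (sym (2*[1+n] n)) (s≤s (s≤s h))

-- For a box with least code X whose left neighbour has greatest index a and whose lower
-- neighbour has greatest letter m.
leftBelow-bound : ∀ a X m → suc (2 * a) ≤ X → upCode m ≤ X → a + idx m + 2 ≤ X + primeBit m
leftBelow-bound a X m h→ h↑ = 2*m≤1+2*n⇒m≤n _ _ (begin
  2 * (a + idx m + 2)                          ≡⟨ e₁ a (idx m) ⟩
  suc (2 * a) + (2 + 2 * idx m) + 1            ≡⟨ cong (λ t → suc (2 * a) + t + 1) (upCode+2*primeBit m) ⟨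
  suc (2 * a) + (upCode m + 2 * primeBit m) + 1 ≤⟨ +-monoˡ-≤ 1 (+-mono-≤ h→ (+-monoˡ-≤ (2 * primeBit m) h↑)) ⟩
  X + (X + 2 * primeBit m) + 1                 ≡⟨ e₂ X (primeBit m) ⟩
  suc (2 * (X + primeBit m))                   ∎)
  where
  open ≤-Reasoning
  e₁ : ∀ a k → 2 * (a + k + 2) ≡ suc (2 * a) + (2 + 2 * k) + 1
  e₁ = solve-∀
  e₂ : ∀ X p → X + (X + 2 * p) + 1 ≡ suc (2 * (X + p))
  e₂ = solve-∀

below-diag-bound : ∀ m c → upCode m ≤ suc (2 * c) → idx m + 1 ≤ c + primeBit m
below-diag-bound m c h↑ = 2*m≤1+2*n⇒m≤n _ _ (begin
  2 * (idx m + 1)                ≡⟨ e₁ (idx m) ⟩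
  2 + 2 * idx m                  ≡⟨ upCode+2*primeBit m ⟨
  upCode m + 2 * primeBit m      ≤⟨ +-monoˡ-≤ (2 * primeBit m) h↑ ⟩
  suc (2 * c) + 2 * primeBit m   ≡⟨ e₂ c (primeBit m) ⟩
  suc (2 * (c + primeBit m))     ∎)
  where
  open ≤-Reasoning
  e₁ : ∀ k → 2 * (k + 1) ≡ 2 + 2 * k
  e₁ = solve-∀
  e₂ : ∀ c p → suc (2 * c) + 2 * p ≡ suc (2 * (c + p))
  e₂ = solve-∀

module StrictShape (la : List ℕ) (sp : StrictPartition la) where

  L : ℕ
  L = length la

  lam : ℕ → ℕ
  lam = part la

  lam-pos : ∀ i → suc i ≤ L → 1 ≤ lam (suc i)
  lam-pos = All⇒part la (proj₁ sp)

  lam-beyond : ∀ {i} → L < i → lam i ≡ 0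
  lam-beyond = part-beyond la

  lam-in : ∀ i → 1 ≤ lam i → i ≤ L
  lam-in i h = ≮⇒≥ (λ L<i → <⇒≱ h (≤-reflexive (lam-beyond L<i)))

  lam-strict : ∀ i → 1 ≤ i → 1 ≤ lam (suc i) → lam (suc i) < lam i
  lam-strict (suc i) _ h = Linked⇒part la (proj₂ sp) i (lam-in (suc (suc i)) h)

  row-pos : ∀ {i j} → i ≤ j → j < i + lam i → 1 ≤ lam i
  row-pos {i} i≤j j< with lam i
  ... | zero  = ⊥-elim (<⇒≱ (subst (_ <_) (+-identityʳ i) j<) i≤j)
  ... | suc _ = s≤s z≤n

  InD-row≤L : ∀ {i j} → InD la i j → i ≤ L
  InD-row≤L {i} (_ , i≤j , j<) = lam-in i (row-pos i≤j j<)

  InD-diag : ∀ i → 1 ≤ lam (suc i) → InD la (suc i) (suc i)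
  InD-diag i h = s≤s z≤n , ≤-refl , m<m+n (suc i) h

  InD-left : ∀ {i j} → i ≤ j → InD la i (suc j) → InD la i j
  InD-left i≤j (i≥1 , _ , j<) = i≥1 , i≤j , <-trans (n<1+n _) j<

  InD-below : ∀ {i j} → 1 ≤ i → InD la (suc i) j → InD la i j
  InD-below {i} {j} i≥1 (_ , i<j , j<) = i≥1 , <⇒≤ i<j , (begin-strict
    j                     <⟨ j< ⟩
    suc i + lam (suc i)   ≡⟨ +-suc i (lam (suc i)) ⟨
    i + suc (lam (suc i)) ≤⟨ +-monoʳ-≤ i (lam-strict i i≥1 (row-pos i<j j<)) ⟩
    i + lam i             ∎)
    where open ≤-Reasoning

-- Consequences of the maximality of Δ

-- Row r of λ splits into its first δ_r boxes, which lie in Δ, and the outer boxes beyond them.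
-- The tail of row r starts at its last Δ-box (at its first box if δ_r = 0).
tailStart : List ℕ → ℕ → ℕ
tailStart Δ r = r + (part Δ r ∸ 1)

tailLength : List ℕ → List ℕ → ℕ → ℕ
tailLength la Δ r = part la r ∸ (part Δ r ∸ 1)

outerStart : List ℕ → ℕ → ℕ
outerStart Δ r = r + part Δ r

outerLength : List ℕ → List ℕ → ℕ → ℕ
outerLength la Δ r = part la r ∸ part Δ r

module LargestDPartition (la : List ℕ) (sp : StrictPartition la)
                         (Δ : List ℕ) (isL : IsLargestDPartitionIn Δ la) where

  open StrictShape la sp public

  ℓ : ℕ
  ℓ = length Δ

  δ : ℕ → ℕ
  δ = part Δ

  δ≤lam : ∀ i → δ i ≤ lam i
  δ≤lam = proj₁ (proj₂ isL)

  δ-pos : ∀ i → suc i ≤ ℓ → 1 ≤ δ (suc i)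
  δ-pos = All⇒part Δ (proj₁ (proj₁ isL))

  δ-gap : ∀ i → suc (suc i) ≤ ℓ → δ (suc (suc i)) + 2 ≤ δ (suc i)
  δ-gap = Linked⇒part Δ (proj₂ (proj₁ isL))

  δ-beyond : ∀ {i} → ℓ < i → δ i ≡ 0
  δ-beyond = part-beyond Δ

  δ-in : ∀ i → 1 ≤ δ i → i ≤ ℓ
  δ-in i h = ≮⇒≥ (λ ℓ<i → <⇒≱ h (≤-reflexive (δ-beyond ℓ<i)))

  ℓ≤L : ℓ ≤ L
  ℓ≤L with ℓ in eq
  ... | zero  = z≤n
  ... | suc k = lam-in (suc k) (≤-trans (δ-pos k (≤-reflexive (sym eq))) (δ≤lam (suc k)))

  private
    not-larger : ∀ μ → DPartition μ → μ ⊆P la → size Δ < size μ → ⊥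
    not-larger μ dμ μ⊆la lt = <⇒≱ lt (proj₂ (proj₂ isL) μ dμ μ⊆la)

  -- Otherwise adding a box to row i+1 of Δ would give a larger D-partition inside λ.
  cannot-grow-row : ∀ i → suc i ≤ ℓ → δ (suc i) < lam (suc i) →
                    (∀ k → i ≡ suc k → δ (suc i) + 3 ≤ δ (suc k)) → ⊥
  cannot-grow-row i i<ℓ room gap = not-larger Δ′ (part⇒All Δ′ pos , part⇒Linked Δ′ link) Δ′⊆la
                                     (≤-reflexive (sym (sum-incrementPart Δ i i<ℓ)))
    where
    Δ′ : List ℕ
    Δ′ = incrementPart Δ (suc i)
    lenΔ′ : length Δ′ ≡ ℓ
    lenΔ′ = length-incrementPart Δ (suc i)
    same : ∀ j → j ≢ i → part Δ′ (suc j) ≡ δ (suc j)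
    same j ne = part-incrementPart-other Δ i j ne
    grown : part Δ′ (suc i) ≡ suc (δ (suc i))
    grown = part-incrementPart-same Δ i i<ℓ
    pos : ∀ j → suc j ≤ length Δ′ → 1 ≤ part Δ′ (suc j)
    pos j q with j ≟ i
    ... | yes refl = subst (1 ≤_) (sym grown) (s≤s z≤n)
    ... | no ne    = subst (1 ≤_) (sym (same j ne)) (δ-pos j (subst (suc j ≤_) lenΔ′ q))
    link : ∀ j → suc (suc j) ≤ length Δ′ → part Δ′ (suc (suc j)) + 2 ≤ part Δ′ (suc j)
    link j q with j ≟ i | suc j ≟ i
    ... | yes refl | _      = subst₂ (λ a b → a + 2 ≤ b) (sym (same (suc i) 1+n≢n)) (sym grown)
                                (≤-trans (δ-gap i (subst (suc (suc i) ≤_) lenΔ′ q)) (n≤1+n _))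
    ... | no ne    | yes e  = subst₂ (λ a b → a + 2 ≤ b) (sym (trans (cong (λ z → part Δ′ (suc z)) e) grown))
                                (sym (same j ne)) (subst (_≤ δ (suc j)) (+-suc (δ (suc i)) 2) (gap j (sym e)))
    ... | no ne    | no ne′ = subst₂ (λ a b → a + 2 ≤ b) (sym (same (suc j) ne′)) (sym (same j ne))
                                (δ-gap j (subst (suc (suc j) ≤_) lenΔ′ q))
    Δ′⊆la : Δ′ ⊆P la
    Δ′⊆la zero = subst (_≤ lam 0) (sym (part-incrementPart-zero Δ i)) z≤n
    Δ′⊆la (suc j) with j ≟ i
    ... | yes refl = subst (_≤ lam (suc i)) (sym grown) room
    ... | no ne    = subst (_≤ lam (suc j)) (sym (same j ne)) (δ≤lam (suc j))

  -- Otherwise appending a part 1 to Δ would give a larger D-partition inside λ.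
  cannot-add-row : ℓ < L → (ℓ ≡ 0 ⊎ 3 ≤ δ ℓ) → ⊥
  cannot-add-row ℓ<L gap = not-larger Δ′ (part⇒All Δ′ pos , part⇒Linked Δ′ link) Δ′⊆la
                             (≤-reflexive (sym (sum-snoc1 Δ)))
    where
    Δ′ : List ℕ
    Δ′ = Δ ++ [ 1 ]
    lenΔ′ : length Δ′ ≡ suc ℓ
    lenΔ′ = length-snoc1 Δ
    pos : ∀ j → suc j ≤ length Δ′ → 1 ≤ part Δ′ (suc j)
    pos j q with suc j ≤? ℓ
    ... | yes p = subst (1 ≤_) (sym (part-snoc1-old Δ (suc j) p)) (δ-pos j p)
    ... | no p  = subst (1 ≤_) (sym (trans (cong (part Δ′) j≡ℓ) (part-snoc1-new Δ))) (s≤s z≤n)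
      where
      j≡ℓ : suc j ≡ suc ℓ
      j≡ℓ = ≤-antisym (subst (suc j ≤_) lenΔ′ q) (≰⇒> p)
    link : ∀ j → suc (suc j) ≤ length Δ′ → part Δ′ (suc (suc j)) + 2 ≤ part Δ′ (suc j)
    link j q with suc (suc j) ≤? ℓ
    ... | yes p = subst₂ (λ a b → a + 2 ≤ b) (sym (part-snoc1-old Δ _ p))
                    (sym (part-snoc1-old Δ _ (≤-trans (n≤1+n _) p))) (δ-gap j p)
    ... | no p  = subst₂ (λ a b → a + 2 ≤ b) (sym (trans (cong (part Δ′ ∘ suc) j≡ℓ) (part-snoc1-new Δ)))
                    (sym (trans (part-snoc1-old Δ (suc j) (≤-reflexive j≡ℓ)) (cong δ j≡ℓ))) (3≤ gap)
      where
      j≡ℓ : suc j ≡ ℓ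
      j≡ℓ = suc-injective (≤-antisym (subst (suc (suc j) ≤_) lenΔ′ q) (≰⇒> p))
      3≤ : (ℓ ≡ 0 ⊎ 3 ≤ δ ℓ) → 3 ≤ δ ℓ
      3≤ (inj₁ e) = ⊥-elim (1+n≢0 (trans j≡ℓ e))
      3≤ (inj₂ h) = h
    Δ′⊆la : Δ′ ⊆P la
    Δ′⊆la j with j ≤? ℓ
    ... | yes p = subst (_≤ lam j) (sym (part-snoc1-old Δ j p)) (δ≤lam j)
    ... | no p with j ≟ suc ℓ
    ...   | yes refl = subst (_≤ lam (suc ℓ)) (sym (part-snoc1-new Δ)) (lam-pos ℓ ℓ<L)
    ...   | no p′    = subst (_≤ lam j) (sym (part-beyond Δ′ (subst (_< j) (sym lenΔ′)
                          (≤∧≢⇒< (≰⇒> p) (p′ ∘ sym))))) z≤n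

  ℓ≥1 : 1 ≤ L → 1 ≤ ℓ
  ℓ≥1 L≥1 with ℓ in eq
  ... | zero  = ⊥-elim (cannot-add-row (subst (_< L) (sym eq) L≥1) (inj₁ eq))
  ... | suc _ = s≤s z≤n

  δ₁≡lam₁ : 1 ≤ ℓ → δ 1 ≡ lam 1
  δ₁≡lam₁ ℓ≥1 = ≤-antisym (δ≤lam 1) (≮⇒≥ (λ room → cannot-grow-row 0 ℓ≥1 room (λ _ ())))

  δ-tight : ∀ i → suc (suc i) ≤ ℓ → δ (suc (suc i)) < lam (suc (suc i)) → δ (suc i) ≤ δ (suc (suc i)) + 2
  δ-tight i i<ℓ room = ≮⇒≥ (λ h → cannot-grow-row (suc i) i<ℓ room
    (λ k e → subst (λ z → δ (suc (suc i)) + 3 ≤ δ (suc z)) (suc-injective e)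
               (subst (_≤ δ (suc i)) (sym (+-suc (δ (suc (suc i))) 2)) h)))

  δ-last≤2 : ℓ < L → δ ℓ ≤ 2
  δ-last≤2 ℓ<L = ≮⇒≥ (λ h → cannot-add-row ℓ<L (inj₂ h))

  inner-below⇒notOuter : ∀ i j → 1 ≤ i → suc j < i + δ i → InD la (suc i) j → ¬ (suc i + δ (suc i) ≤ j)
  inner-below⇒notOuter (suc i′) j _ inner h↑ outer with 1 ≤? δ (suc (suc i′))
  ... | yes δ≥1 = <⇒≱ inner (≤-trans (≤-trans (+-monoʳ-≤ i (δ-tight i′ (δ-in (suc i) δ≥1) δ<lam))
                                                 (≤-reflexive (e i (δ (suc i)))))
                                        (s≤s outer))
    where
    i = suc i′
    δ<lam : δ (suc i) < lam (suc i)
    δ<lam = +-cancelˡ-< (suc i) (δ (suc i)) (lam (suc i)) (≤-<-trans outer (proj₂ (proj₂ h↑)))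
    e : ∀ i d → i + (d + 2) ≡ suc (suc i + d)
    e = solve-∀
  ... | no δ≱1 = <⇒≱ (≤-trans 3≤δ (≤-reflexive (cong δ i≡ℓ))) (δ-last≤2 ℓ<L)
    where
    i = suc i′
    3≤δ : 3 ≤ δ i
    3≤δ = +-cancelˡ-≤ i 3 (δ i) (≤-trans (≤-reflexive (+-comm i 3)) (≤-trans (s≤s (s≤s (proj₁ (proj₂ h↑)))) inner))
    i≡ℓ : i ≡ ℓ
    i≡ℓ = ≤-antisym (δ-in i (≤-trans (s≤s z≤n) 3≤δ)) (≮⇒≥ (λ i<ℓ → δ≱1 (δ-pos i i<ℓ)))
    ℓ<L : ℓ < L
    ℓ<L = subst (λ t → suc t ≤ L) i≡ℓ (InD-row≤L h↑)

  tail-below⇒outer : ∀ i j → 1 ≤ i → i + δ i ≤ suc j → InD la (suc i) j → suc i + δ (suc i) ≤ j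
  tail-below⇒outer (suc i′) j _ tail h↑ with 1 ≤? δ (suc (suc i′))
  ... | yes δ≥1 = ≤-pred (≤-trans (≤-reflexive (e i (δ (suc i)))) (≤-trans (+-monoʳ-≤ i (δ-gap i′ (δ-in (suc i) δ≥1))) tail))
    where
    i = suc i′
    e : ∀ i d → suc (suc i + d) ≡ i + (d + 2)
    e = solve-∀
  ... | no δ≱1 = subst (λ t → suc (suc i′) + t ≤ j) (sym (n<1⇒n≡0 (≰⇒> δ≱1)))
                   (subst (_≤ j) (sym (+-identityʳ (suc (suc i′)))) (proj₁ (proj₂ h↑)))

  outer⇒tail-below : ∀ i j → 1 ≤ i → InD la (suc i) j → suc i + δ (suc i) ≤ j → i + δ i ≤ suc j
  outer⇒tail-below i j i≥1 h↑ outer = ≮⇒≥ (λ inner → inner-below⇒notOuter i j i≥1 inner h↑ outer)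

  tailStart+tailLength : ∀ r → tailStart Δ r + tailLength la Δ r ≡ r + lam r
  tailStart+tailLength r = trans (+-assoc r (δ r ∸ 1) _)
    (cong (r +_) (m+[n∸m]≡n (≤-trans (m∸n≤m (δ r) 1) (δ≤lam r))))

  outerStart+outerLength : ∀ r → outerStart Δ r + outerLength la Δ r ≡ r + lam r
  outerStart+outerLength r = trans (+-assoc r (δ r) _) (cong (r +_) (m+[n∸m]≡n (δ≤lam r)))

offDiagonal : ℕ → ℕ → ℕ → ℕ
offDiagonal i j c with i ≟ j
... | yes _ = 0
... | no _  = c

offDiagonal-diag : ∀ i c → offDiagonal i i c ≡ 0
offDiagonal-diag i c with i ≟ i
... | yes _ = refl
... | no ne = ⊥-elim (ne refl)

offDiagonal-off : ∀ {i j} c → i ≢ j → offDiagonal i j c ≡ c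
offDiagonal-off {i} {j} c ne with i ≟ j
... | yes e = ⊥-elim (ne e)
... | no _  = refl

slackOf : (right up : ℕ → ℕ → ℕ) → ℕ → ℕ → ℕ
slackOf right up i j = right i j + offDiagonal i j (up i j)

slackOf-diag : ∀ right up i → slackOf right up i i ≡ right i i
slackOf-diag right up i = trans (cong (right i i +_) (offDiagonal-diag i (up i i))) (+-identityʳ _)

slackOf-offDiag : ∀ right up {i j} → i ≢ j → slackOf right up i j ≡ right i j + up i j
slackOf-offDiag right up ne = cong (_ +_) (offDiagonal-off _ ne)

module Tableau (n : ℕ) (la : List ℕ) (sp : StrictPartition la)
               (T : ℕ → ℕ → Filling) (isT : IsPSVT la n T) where

  open StrictShape la sp

  entries : ℕ → ℕ → ℕ
  entries i j = length (T i j)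

  least greatest : ℕ → ℕ → Letter
  least i j    = minOf (T i j)
  greatest i j = maxOf (T i j)

  leastCode : ℕ → ℕ → ℕ
  leastCode i j = code (least i j)

  -- 2n+1 − code (greatest i j), split into the room left for the box to the right
  -- and for the box above.
  rightSlack upSlack : ℕ → ℕ → ℕ
  rightSlack i j = n ∸ idx (greatest i j)
  upSlack i j    = n ∸ idx (greatest i j) + primeBit (greatest i j)

  slack : ℕ → ℕ → ℕ
  slack = slackOf rightSlack upSlack

  diagonal-unprimed : ∀ i → InD la i i → All (λ x → isPrimed x ≡ false) (T i i)
  diagonal-unprimed = proj₂ (proj₂ (proj₂ isT))

  module _ {i j : ℕ} (h : InD la i j) where

    filled : T i j ≢ []
    filled = proj₁ (proj₁ isT i j h)

    increasing : Linked _<L_ (T i j)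
    increasing = proj₁ (proj₂ (proj₁ isT i j h))

    inAlphabet : All (λ z → 1 ≤ idx z × idx z ≤ n) (T i j)
    inAlphabet = proj₂ (proj₂ (proj₁ isT i j h))

    1≤idx-least : 1 ≤ idx (least i j)
    1≤idx-least = proj₁ (All-minOf (T i j) inAlphabet filled)

    entries+leastCode≤ : entries i j + leastCode i j ≤ code (greatest i j) + 1
    entries+leastCode≤ = length+code≤ (T i j) increasing filled

    leastCode≤ : leastCode i j ≤ code (greatest i j)
    leastCode≤ = +-cancelʳ-≤ 1 _ _ (≤-trans (≤-reflexive (+-comm (leastCode i j) 1))
                   (≤-trans (+-monoˡ-≤ (leastCode i j) (1≤length (T i j) filled)) entries+leastCode≤))

    rightSlack+idx≡n : rightSlack i j + idx (greatest i j) ≡ n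
    rightSlack+idx≡n = m∸n+n≡m (proj₂ (All-maxOf (T i j) inAlphabet filled))

    slacks+code≡ : rightSlack i j + upSlack i j + code (greatest i j) ≡ n + n + 1
    slacks+code≡ = begin
      F + (F + p) + code M          ≡⟨ regroup F p (code M) ⟩
      F + F + (code M + p)          ≡⟨ cong (F + F +_) (code+primeBit M) ⟩
      F + F + suc (2 * idx M)       ≡⟨ regroup′ F (idx M) ⟩
      (F + idx M) + (F + idx M) + 1 ≡⟨ cong (λ t → t + t + 1) rightSlack+idx≡n ⟩
      n + n + 1                     ∎
      where
      open ≡-Reasoning
      M = greatest i j
      F = rightSlack i j
      p = primeBit M
      regroup : ∀ a p c → a + (a + p) + c ≡ a + a + (c + p)
      regroup = solve-∀
      regroup′ : ∀ a k → a + a + suc (2 * k) ≡ (a + k) + (a + k) + 1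
      regroup′ = solve-∀

  entries+slack+idx≤-diag : ∀ i → InD la i i → entries i i + slack i i + idx (least i i) ≤ n + 1
  entries+slack+idx≤-diag i h = begin
    entries i i + slack i i + idx (least i i)  ≡⟨ cong (λ t → entries i i + t + idx (least i i)) (slackOf-diag rightSlack upSlack i) ⟩
    entries i i + F + idx (least i i)          ≡⟨ swap (entries i i) F (idx (least i i)) ⟩
    entries i i + idx (least i i) + F          ≤⟨ +-monoˡ-≤ F (length+idx≤ (T i i) (increasing h) (diagonal-unprimed i h) (filled h)) ⟩
    idx (greatest i i) + 1 + F                 ≡⟨ swap′ (idx (greatest i i)) F ⟩
    F + idx (greatest i i) + 1                 ≡⟨ cong (_+ 1) (rightSlack+idx≡n h) ⟩
    n + 1                                      ∎
    where
    open ≤-Reasoning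
    F = rightSlack i i
    swap : ∀ a b c → a + b + c ≡ a + c + b
    swap = solve-∀
    swap′ : ∀ a b → a + 1 + b ≡ b + a + 1
    swap′ = solve-∀

  entries+slack+leastCode≤-offDiag : ∀ i j → InD la i j → i ≢ j → entries i j + slack i j + leastCode i j ≤ n + n + 2
  entries+slack+leastCode≤-offDiag i j h i≢j = begin
    entries i j + slack i j + leastCode i j   ≡⟨ cong (λ t → entries i j + t + leastCode i j) (slackOf-offDiag rightSlack upSlack i≢j) ⟩
    entries i j + FC + leastCode i j          ≡⟨ swap (entries i j) FC (leastCode i j) ⟩
    entries i j + leastCode i j + FC          ≤⟨ +-monoˡ-≤ FC (entries+leastCode≤ h) ⟩
    code (greatest i j) + 1 + FC              ≡⟨ swap′ (code (greatest i j)) FC ⟩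
    FC + code (greatest i j) + 1              ≡⟨ cong (_+ 1) (slacks+code≡ h) ⟩
    n + n + 1 + 1                             ≡⟨ +-assoc (n + n) 1 1 ⟩
    n + n + 2                                 ∎
    where
    open ≤-Reasoning
    FC = rightSlack i j + upSlack i j
    swap : ∀ a b c → a + b + c ≡ a + c + b
    swap = solve-∀
    swap′ : ∀ a b → a + 1 + b ≡ b + a + 1
    swap′ = solve-∀

  upCode≤leastCode-above : ∀ i j → InD la i j → InD la (suc i) j → upCode (greatest i j) ≤ leastCode (suc i) j
  upCode≤leastCode-above i j h h↑ = UpOK⇒upCode≤ (greatest i j) (least (suc i) j)
    (subst₂ UpOK (last≡maxOf (T i j) (filled h)) (head≡minOf (T (suc i) j) (filled h↑))
      (proj₁ (proj₂ isT) i j h h↑))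

  1+2*idx≤leastCode-right : ∀ i j → InD la i j → InD la i (suc j) →
                            suc (2 * idx (greatest i j)) ≤ leastCode i (suc j)
  1+2*idx≤leastCode-right i j h h→ = RightOK⇒1+2*idx≤ (greatest i j) (least i (suc j))
    (subst₂ RightOK (last≡maxOf (T i j) (filled h)) (head≡minOf (T i (suc j)) (filled h→))
      (proj₁ (proj₂ (proj₂ isT)) i j h h→))

  entries+leastCode≤-right : ∀ i j → InD la i j → InD la i (suc j) →
                             entries i j + leastCode i j ≤ leastCode i (suc j) + 1
  entries+leastCode≤-right i j h h→ = ≤-trans (entries+leastCode≤ h)
    (+-monoˡ-≤ 1 (≤-trans (code≤1+2*idx (greatest i j)) (1+2*idx≤leastCode-right i j h h→)))

  leastCode-diag : ∀ i → InD la i i → leastCode i i ≡ suc (2 * idx (least i i))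
  leastCode-diag i h = code-unprimed (least i i) (All-minOf (T i i) (diagonal-unprimed i h) (filled h))

  private
    diag-step : ∀ k → InD la (suc (suc k)) (suc (suc k)) → suc k ≤ idx (least (suc k) (suc k)) →
                suc (suc k) ≤ idx (least (suc (suc k)) (suc (suc k)))
    diag-step k h ih = 2*m≤1+2*n⇒m≤n _ _ (begin
      2 * suc r                               ≤⟨ 2*[1+n]≤upCode r M right ⟩
      upCode M                                ≤⟨ upCode≤leastCode-above r (suc r) h→ h ⟩
      leastCode (suc r) (suc r)               ≡⟨ leastCode-diag (suc r) h ⟩
      suc (2 * idx (least (suc r) (suc r)))   ∎)
      where
      open ≤-Reasoning
      r = suc k
      M = greatest r (suc r)
      h→ : InD la r (suc r)
      h→ = InD-below (s≤s z≤n) h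
      h↙ : InD la r r
      h↙ = InD-left ≤-refl h→
      right : suc (2 * r) ≤ code M
      right = ≤-trans (s≤s (*-monoʳ-≤ 2 (≤-trans ih (code≤⇒idx≤ (least r r) (greatest r r) (leastCode≤ h↙)))))
                (≤-trans (1+2*idx≤leastCode-right r r h↙ h→) (leastCode≤ h→))

  i≤idx-least-diag : ∀ i → InD la i i → i ≤ idx (least i i)
  i≤idx-least-diag zero          (() , _)
  i≤idx-least-diag (suc zero)    h = 1≤idx-least h
  i≤idx-least-diag (suc (suc k)) h =
    diag-step k h (i≤idx-least-diag (suc k) (InD-left ≤-refl (InD-below (s≤s z≤n) h)))

  entries+slack≤-offDiag : ∀ i j → InD la (suc i) (suc j) → InD la (suc i) j → InD la i (suc j) → i ≢ j →
                           entries (suc i) (suc j) + slack (suc i) (suc j) ≤ rightSlack (suc i) j + upSlack i (suc j)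
  entries+slack≤-offDiag i j hC h← h↓ i≢j =
    combine (entries (suc i) (suc j)) (slack (suc i) (suc j)) (leastCode (suc i) (suc j)) (code (greatest (suc i) (suc j)))
      a b (primeBit (greatest i (suc j))) (n ∸ a) (n ∸ b) (entries+leastCode≤ hC) slack+code≡
    (leftBelow-bound a (leastCode (suc i) (suc j)) (greatest i (suc j))
      (1+2*idx≤leastCode-right (suc i) j h← hC) (upCode≤leastCode-above i (suc j) h↓ hC))
    where
    a = idx (greatest (suc i) j)
    b = idx (greatest i (suc j))
    slack+code≡ : slack (suc i) (suc j) + code (greatest (suc i) (suc j)) ≡ (n ∸ a) + a + ((n ∸ b) + b) + 1
    slack+code≡ = trans (cong (_+ code (greatest (suc i) (suc j))) (slackOf-offDiag rightSlack upSlack (i≢j ∘ suc-injective)))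
                    (trans (slacks+code≡ hC) (cong₂ (λ u v → u + v + 1) (sym (rightSlack+idx≡n h←)) (sym (rightSlack+idx≡n h↓))))
    combine : ∀ s w X c a b p A B → s + X ≤ c + 1 → w + c ≡ A + a + (B + b) + 1 → a + b + 2 ≤ X + p → s + w ≤ A + (B + p)
    combine s w X c a b p A B h₁ h₂ h₃ = +-cancelʳ-≤ (a + b + 2 + c) (s + w) (A + (B + p)) (begin
      s + w + (a + b + 2 + c)              ≡⟨ e₁ s w (a + b + 2) c ⟩
      s + w + c + (a + b + 2)              ≤⟨ +-monoʳ-≤ (s + w + c) h₃ ⟩
      s + w + c + (X + p)                  ≡⟨ e₂ s w c X p ⟩
      (s + X) + (w + c) + p                ≤⟨ +-monoˡ-≤ p (+-monoˡ-≤ (w + c) h₁) ⟩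
      (c + 1) + (w + c) + p                ≡⟨ cong (λ t → (c + 1) + t + p) h₂ ⟩
      (c + 1) + (A + a + (B + b) + 1) + p  ≡⟨ e₃ c A a B b p ⟩
      A + (B + p) + (a + b + 2 + c)        ∎)
      where
      open ≤-Reasoning
      e₁ : ∀ s w q c → s + w + (q + c) ≡ s + w + c + q
      e₁ = solve-∀
      e₂ : ∀ s w c X p → s + w + c + (X + p) ≡ (s + X) + (w + c) + p
      e₂ = solve-∀
      e₃ : ∀ c A a B b p → (c + 1) + (A + a + (B + b) + 1) + p ≡ A + (B + p) + (a + b + 2 + c)
      e₃ = solve-∀

  entries+slack≤-diag : ∀ i → InD la (suc i) (suc i) → InD la i (suc i) →
                        entries (suc i) (suc i) + slack (suc i) (suc i) ≤ upSlack i (suc i)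
  entries+slack≤-diag i hC h↓ = subst (λ t → entries C C + t ≤ upSlack i C) (sym (slackOf-diag rightSlack upSlack C))
    (combine (entries C C) (rightSlack C C) (idx (least C C)) (idx (greatest C C)) (idx (greatest i C))
      (primeBit (greatest i C)) (n ∸ idx (greatest i C)) (length+idx≤ (T C C) (increasing hC) (diagonal-unprimed C hC) (filled hC))
      (trans (rightSlack+idx≡n hC) (sym (rightSlack+idx≡n h↓)))
      (below-diag-bound (greatest i C) (idx (least C C)) (subst (upCode (greatest i C) ≤_) (leastCode-diag C hC) (upCode≤leastCode-above i C h↓ hC))))
    where
    C = suc i
    combine : ∀ s F c m b p B → s + c ≤ m + 1 → F + m ≡ B + b → b + 1 ≤ c + p → s + F ≤ B + p
    combine s F c m b p B h₁ h₂ h₃ = +-cancelʳ-≤ (b + 1 + m) (s + F) (B + p) (begin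
      s + F + (b + 1 + m)      ≡⟨ e₁ s F (b + 1) m ⟩
      s + F + m + (b + 1)      ≤⟨ +-monoʳ-≤ (s + F + m) h₃ ⟩
      s + F + m + (c + p)      ≡⟨ e₂ s F m c p ⟩
      (s + c) + (F + m) + p    ≤⟨ +-monoˡ-≤ p (+-monoˡ-≤ (F + m) h₁) ⟩
      (m + 1) + (F + m) + p    ≡⟨ cong (λ t → (m + 1) + t + p) h₂ ⟩
      (m + 1) + (B + b) + p    ≡⟨ e₃ m B b p ⟩
      B + p + (b + 1 + m)      ∎)
      where
      open ≤-Reasoning
      e₁ : ∀ s w q c → s + w + (q + c) ≡ s + w + c + q
      e₁ = solve-∀
      e₂ : ∀ s F m c p → s + F + m + (c + p) ≡ (s + c) + (F + m) + p
      e₂ = solve-∀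
      e₃ : ∀ m B b p → (m + 1) + (B + b) + p ≡ B + p + (b + 1 + m)
      e₃ = solve-∀

  1+2i≤leastCode-diag : ∀ i → InD la i i → suc (i + i) ≤ leastCode i i
  1+2i≤leastCode-diag i h = begin
    suc (i + i)                         ≤⟨ s≤s (+-mono-≤ i≤ i≤) ⟩
    suc (idx (least i i) + idx (least i i)) ≡⟨ cong (λ t → suc (idx (least i i) + t)) (+-identityʳ _) ⟨
    suc (2 * idx (least i i))           ≡⟨ leastCode-diag i h ⟨
    leastCode i i                       ∎
    where
    open ≤-Reasoning
    i≤ = i≤idx-least-diag i h

-- The slack argument

-- It is run twice: with ≤ for an arbitrary tableau, and with ≡ for the extremal one.
record AdditivePreorder : Set₁ where
  infix 4 _≲_
  field
    _≲_         : ℕ → ℕ → Set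
    isPreorder  : IsPreorder _≡_ _≲_
    +-mono-≲    : ∀ {a b c d} → a ≲ b → c ≲ d → a + c ≲ b + d
    +-cancelʳ-≲ : ∀ a b c → a + c ≲ b + c → a ≲ b

  open IsPreorder isPreorder public
    using () renaming (refl to ≲-refl; reflexive to ≲-reflexive; trans to ≲-trans)

  ≲-preorder : Preorder _ _ _
  ≲-preorder = record { isPreorder = isPreorder }

  module ≲-Reasoning = Relation.Binary.Reasoning.Preorder ≲-preorder

  sumRange-mono-≲ : ∀ {f g} a k → (∀ j → InRange a k j → f j ≲ g j) → sumRange f a k ≲ sumRange g a k
  sumRange-mono-≲ a zero    _   = ≲-refl
  sumRange-mono-≲ a (suc k) f≲g =
    +-mono-≲ (f≲g a (InRange-head a k)) (sumRange-mono-≲ (suc a) k (λ j r → f≲g j (InRange-tail r)))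

  0≲sumRange : ∀ f a k → (∀ j → InRange a k j → 0 ≲ f j) → 0 ≲ sumRange f a k
  0≲sumRange f a k 0≲f = ≲-trans (≲-reflexive (sym (sumRange-const0 a k))) (sumRange-mono-≲ a k 0≲f)

  sumRange-subrange : ∀ f a m b k → a ≤ b → b + k ≤ a + m →
                      (∀ j → InRange a m j → ¬ InRange b k j → 0 ≲ f j) → sumRange f b k ≲ sumRange f a m
  sumRange-subrange f a m b k a≤b b+k≤ outside = begin
    sumRange f b k                                            ≡⟨ trans (+-identityˡ _) (+-identityʳ _) ⟨
    0 + (sumRange f b k + 0)                                  ≲⟨ +-mono-≲ (0≲sumRange f a p before) (+-mono-≲ ≲-refl (0≲sumRange f (b + k) q after)) ⟩
    sumRange f a p + (sumRange f b k + sumRange f (b + k) q)  ≡⟨ split ⟨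
    sumRange f a m                                            ∎
    where
    open ≲-Reasoning
    p = b ∸ a
    q = (a + m) ∸ (b + k)
    a+p : a + p ≡ b
    a+p = m+[n∸m]≡n a≤b
    b+k+q : b + k + q ≡ a + m
    b+k+q = m+[n∸m]≡n b+k≤
    m≡ : m ≡ p + (k + q)
    m≡ = +-cancelˡ-≡ a _ _ (trans (sym b+k+q)
           (trans (cong (λ t → t + k + q) (sym a+p)) (trans (+-assoc (a + p) k q) (+-assoc a p (k + q)))))
    split : sumRange f a m ≡ sumRange f a p + (sumRange f b k + sumRange f (b + k) q)
    split = trans (cong (sumRange f a) m≡) (trans (sumRange-split f a p (k + q))
              (cong (sumRange f a p +_) (trans (cong (λ t → sumRange f t (k + q)) a+p) (sumRange-split f b k q))))
    before : ∀ j → InRange a p j → 0 ≲ f j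
    before j (a≤j , j<) = outside j (a≤j , <-≤-trans j< (≤-trans (≤-reflexive a+p)
                            (≤-trans (m≤m+n b k) (≤-trans (m≤m+n (b + k) q) (≤-reflexive b+k+q)))))
                            (λ j∈ → <⇒≱ (subst (j <_) a+p j<) (proj₁ j∈))
    after : ∀ j → InRange (b + k) q j → 0 ≲ f j
    after j (b+k≤j , j<) = outside j (≤-trans a≤b (≤-trans (m≤m+n b k) b+k≤j) , subst (j <_) b+k+q j<)
                             (λ j∈ → <⇒≱ (proj₂ j∈) b+k≤j)

  sumRange-telescope : ∀ (g y : ℕ → ℕ) a k → (∀ j → InRange a k j → g j + y j ≲ y (suc j) + 1) →
                       sumRange g a k + y a ≲ y (a + k) + k
  sumRange-telescope g y a zero    _    = ≲-reflexive (sym (trans (+-identityʳ _) (cong y (+-identityʳ a))))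
  sumRange-telescope g y a (suc k) step = begin
    g a + S + y a                ≡⟨ e₁ (g a) S (y a) ⟩
    (g a + y a) + S              ≲⟨ +-mono-≲ (step a (InRange-head a k)) ≲-refl ⟩
    (y (suc a) + 1) + S          ≡⟨ e₂ (y (suc a)) S ⟩
    1 + (S + y (suc a))          ≲⟨ +-mono-≲ {1} ≲-refl (sumRange-telescope g y (suc a) k (λ j r → step j (InRange-tail r))) ⟩
    1 + (y (suc a + k) + k)      ≡⟨ cong (λ t → suc (y t + k)) (+-suc a k) ⟨
    1 + (y (a + suc k) + k)      ≡⟨ +-suc (y (a + suc k)) k ⟨
    y (a + suc k) + suc k        ∎
    where
    open ≲-Reasoning
    S = sumRange g (suc a) k
    e₁ : ∀ p q r → p + q + r ≡ (p + r) + q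
    e₁ = solve-∀
    e₂ : ∀ p q → p + 1 + q ≡ 1 + (q + p)
    e₂ = solve-∀

≤-additivePreorder : AdditivePreorder
≤-additivePreorder = record
  { _≲_ = _≤_ ; isPreorder = ≤-isPreorder ; +-mono-≲ = +-mono-≤ ; +-cancelʳ-≲ = λ a b c → +-cancelʳ-≤ c a b }

≡-additivePreorder : AdditivePreorder
≡-additivePreorder = record
  { _≲_ = _≡_ ; isPreorder = ≡-isPreorder ; +-mono-≲ = cong₂ _+_ ; +-cancelʳ-≲ = λ a b c → +-cancelʳ-≡ c a b }

-- What the Δ-boxes of row r can hold when δ_r = d: the codes 2r+1, …, 2n+1, each shared by
-- two neighbouring boxes, or the unprimed letters r, …, n in a single diagonal box.
rowBound : ℕ → ℕ → ℕ → ℕ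
rowBound n r zero          = 0
rowBound n r (suc zero)    = n + 1 ∸ r
rowBound n r (suc (suc d)) = n + n + suc (suc d) ∸ (r + r)

record LocalBounds (R : AdditivePreorder) (la Δ : List ℕ) (n : ℕ) : Set where
  open AdditivePreorder R
  field
    entries rightSlack upSlack : ℕ → ℕ → ℕ
    least : ℕ → ℕ → Letter

    inΔ-step : ∀ r j → InD la r j → InD la r (suc j) → suc (suc j) ≤ r + part Δ r →
               entries r j + code (least r j) ≲ code (least r (suc j)) + 1
    lastΔ-offDiag : ∀ r j → InD la r j → r ≢ j → suc j ≡ r + part Δ r →
                    entries r j + slackOf rightSlack upSlack r j + code (least r j) ≲ n + n + 2
    lastΔ-diag : ∀ r → InD la r r → part Δ r ≡ 1 →
                 entries r r + slackOf rightSlack upSlack r r + idx (least r r) ≲ n + 1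
    firstΔ-leastCode : ∀ r → InD la r r → 2 ≤ part Δ r → suc (r + r) ≲ code (least r r)
    firstΔ-leastIdx : ∀ r → InD la r r → part Δ r ≡ 1 → r ≲ idx (least r r)
    outer-offDiag : ∀ i j → InD la (suc i) (suc j) → InD la (suc i) j → InD la i (suc j) → i ≢ j →
                    suc i + part Δ (suc i) ≤ suc j →
                    entries (suc i) (suc j) + slackOf rightSlack upSlack (suc i) (suc j) ≲ rightSlack (suc i) j + upSlack i (suc j)
    outer-diag : ∀ i → InD la (suc i) (suc i) → InD la i (suc i) → part Δ (suc i) ≡ 0 →
                 entries (suc i) (suc i) + slackOf rightSlack upSlack (suc i) (suc i) ≲ upSlack i (suc i)
    rightSlack-rowEnd : ∀ r → 1 ≤ r → r ≤ length la → 0 ≲ rightSlack r (r + part la r ∸ 1)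
    upSlack-unused : ∀ r j → 1 ≤ r → r ≤ length la → InRange (tailStart Δ r) (tailLength la Δ r) j →
                     ¬ InRange (outerStart Δ (suc r)) (outerLength la Δ (suc r)) j →
                     0 ≲ offDiagonal r j (upSlack r j)

module SlackArgument (la : List ℕ) (sp : StrictPartition la) (Δ : List ℕ) (isL : IsLargestDPartitionIn Δ la)
                     (n : ℕ) (L≤n : length la ≤ n) (R : AdditivePreorder) (B : LocalBounds R la Δ n) where

  open LargestDPartition la sp Δ isL
  open AdditivePreorder R
  open LocalBounds B

  slack entries+slack leastCode : ℕ → ℕ → ℕ
  slack = slackOf rightSlack upSlack
  leastCode r j = code (least r j)
  entries+slack r j = entries r j + slack r j

  entriesOfRow tailSlack tailRightSlack upSlackUnderOuter : ℕ → ℕ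
  entriesOfRow r      = sumRange (entries r) r (lam r)
  tailSlack r         = sumRange (slack r) (tailStart Δ r) (tailLength la Δ r)
  tailRightSlack r    = sumRange (rightSlack r) (tailStart Δ r) (tailLength la Δ r ∸ 1)
  upSlackUnderOuter i = sumRange (upSlack i) (outerStart Δ (suc i)) (outerLength la Δ (suc i))

  outer-run : ∀ i a k → 1 ≤ i → suc i ≤ a → suc a + k ≤ suc i + lam (suc i) → suc i + δ (suc i) ≤ suc a →
              sumRange (entries+slack (suc i)) (suc a) k ≲
              sumRange (rightSlack (suc i)) a k + sumRange (upSlack i) (suc a) k
  outer-run i a k i≥1 i<a end outerFrom = begin
    sumRange (entries+slack (suc i)) (suc a) k
      ≲⟨ sumRange-mono-≲ (suc a) k box ⟩
    sumRange (λ j → rightSlack (suc i) (pred j) + upSlack i j) (suc a) k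
      ≡⟨ sumRange-+ (λ j → rightSlack (suc i) (pred j)) (upSlack i) (suc a) k ⟩
    sumRange (λ j → rightSlack (suc i) (pred j)) (suc a) k + sumRange (upSlack i) (suc a) k
      ≡⟨ cong (_+ sumRange (upSlack i) (suc a) k) (sumRange-suc (λ j → rightSlack (suc i) (pred j)) a k) ⟩
    sumRange (rightSlack (suc i)) a k + sumRange (upSlack i) (suc a) k
      ∎
    where
    open ≲-Reasoning
    box : ∀ j → InRange (suc a) k j → entries+slack (suc i) j ≲ rightSlack (suc i) (pred j) + upSlack i j
    box zero    (() , _)
    box (suc j) (a<j , j<) = outer-offDiag i j hC (InD-left i<j hC) (InD-below i≥1 hC) (<⇒≢ i<j) (≤-trans outerFrom a<j)
      where
      i<j : suc i ≤ j
      i<j = ≤-trans i<a (≤-pred a<j)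
      hC : InD la (suc i) (suc j)
      hC = s≤s z≤n , s≤s (<⇒≤ i<j) , <-≤-trans j< end

  outer-row : ∀ i m → 1 ≤ i → lam (suc i) ≡ suc m → δ (suc i) ≡ 0 →
              sumRange (entries+slack (suc i)) (suc i) (suc m) ≲
              sumRange (rightSlack (suc i)) (suc i) m + sumRange (upSlack i) (suc i) (suc m)
  outer-row i m i≥1 lam≡ δ≡0 = begin
    entries+slack r r + sumRange (entries+slack r) (suc r) m
      ≲⟨ +-mono-≲ (outer-diag i hC (InD-below i≥1 hC) δ≡0) (outer-run i r m i≥1 ≤-refl end outerFrom) ⟩
    upSlack i r + (sumRange (rightSlack r) r m + sumRange (upSlack i) (suc r) m)
      ≡⟨ +-comm-middle (upSlack i r) (sumRange (rightSlack r) r m) (sumRange (upSlack i) (suc r) m) ⟩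
    sumRange (rightSlack r) r m + (upSlack i r + sumRange (upSlack i) (suc r) m)
      ∎
    where
    open ≲-Reasoning
    r = suc i
    +-comm-middle : ∀ a b c → a + (b + c) ≡ b + (a + c)
    +-comm-middle = solve-∀
    hC : InD la r r
    hC = InD-diag i (subst (1 ≤_) (sym lam≡) (s≤s z≤n))
    end : suc r + m ≤ r + lam r
    end = ≤-reflexive (trans (sym (+-suc r m)) (cong (r +_) (sym lam≡)))
    outerFrom : r + δ r ≤ suc r
    outerFrom = ≤-trans (≤-reflexive (trans (cong (r +_) δ≡0) (+-identityʳ r))) (n≤1+n r)

  r≤n : ∀ r → 1 ≤ δ r → r ≤ n
  r≤n r h = ≤-trans (δ-in r h) (≤-trans ℓ≤L L≤n)

  InD-Δ : ∀ {r d j} → 1 ≤ r → δ r ≡ suc d → r ≤ j → j ≤ r + d → InD la r j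
  InD-Δ {r} {d} r≥1 δ≡ r≤j j≤ = r≥1 , r≤j , <-≤-trans (s≤s j≤) (≤-trans (≤-reflexive (sym (+-suc r d)))
                                  (+-monoʳ-≤ r (subst (_≤ lam r) δ≡ (δ≤lam r))))

  Δ-prefix : ∀ r d → 1 ≤ r → δ r ≡ suc d → sumRange (entries r) r d + leastCode r r ≲ leastCode r (r + d) + d
  Δ-prefix r d r≥1 δ≡ = sumRange-telescope (entries r) (leastCode r) r d step
    where
    step : ∀ j → InRange r d j → entries r j + leastCode r j ≲ leastCode r (suc j) + 1
    step j (r≤j , j<) = inΔ-step r j (InD-Δ r≥1 δ≡ r≤j (<⇒≤ j<)) (InD-Δ r≥1 δ≡ (m≤n⇒m≤1+n r≤j) j<)
                          (≤-trans (s≤s j<) (≤-reflexive (trans (sym (+-suc r d)) (cong (r +_) (sym δ≡)))))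

  Δ-part-single : ∀ r → 1 ≤ r → δ r ≡ 1 → sumRange (entries r) r 0 + entries+slack r (r + 0) ≲ rowBound n r 1
  Δ-part-single r r≥1 δ≡1 = +-cancelʳ-≲ _ _ r (begin
    sumRange (entries r) r 0 + entries+slack r (r + 0) + r  ≡⟨ cong (λ t → entries+slack r t + r) (+-identityʳ r) ⟩
    entries+slack r r + r                                  ≲⟨ +-mono-≲ ≲-refl (firstΔ-leastIdx r hC δ≡1) ⟩
    entries r r + slack r r + idx (least r r)              ≲⟨ lastΔ-diag r hC δ≡1 ⟩
    n + 1                                                  ≡⟨ m∸n+n≡m r≤n+1 ⟨
    n + 1 ∸ r + r                                          ∎)
    where
    open ≲-Reasoning
    hC : InD la r r
    hC = InD-Δ r≥1 δ≡1 ≤-refl (m≤m+n r 0)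
    r≤n+1 : r ≤ n + 1
    r≤n+1 = ≤-trans (r≤n r (≤-reflexive (sym δ≡1))) (m≤m+n n 1)

  Δ-part-long : ∀ r d′ → 1 ≤ r → δ r ≡ suc (suc d′) →
                sumRange (entries r) r (suc d′) + entries+slack r (r + suc d′) ≲ rowBound n r (suc (suc d′))
  Δ-part-long r d′ r≥1 δ≡ = +-cancelʳ-≲ _ _ (suc (r + r)) (begin
    sumRange (entries r) r d + entries+slack r s + suc (r + r)
      ≲⟨ +-mono-≲ ≲-refl (firstΔ-leastCode r (InD-Δ r≥1 δ≡ ≤-refl (m≤m+n r d)) (≤-trans (s≤s (s≤s z≤n)) (≤-reflexive (sym δ≡)))) ⟩
    sumRange (entries r) r d + entries+slack r s + leastCode r r
      ≡⟨ e₁ (sumRange (entries r) r d) (entries+slack r s) (leastCode r r) ⟩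
    (sumRange (entries r) r d + leastCode r r) + entries+slack r s
      ≲⟨ +-mono-≲ (Δ-prefix r d r≥1 δ≡) ≲-refl ⟩
    (leastCode r s + d) + entries+slack r s
      ≡⟨ e₂ (leastCode r s) d (entries r s) (slack r s) ⟩
    (entries r s + slack r s + leastCode r s) + d
      ≲⟨ +-mono-≲ (lastΔ-offDiag r s (InD-Δ r≥1 δ≡ (m≤m+n r d) ≤-refl) r≢s (trans (sym (+-suc r d)) (cong (r +_) (sym δ≡)))) ≲-refl ⟩
    n + n + 2 + d
      ≡⟨ trans (e₃ n d′) (trans (cong suc (sym (m∸n+n≡m 2r≤N))) (sym (+-suc (N ∸ (r + r)) (r + r)))) ⟩
    N ∸ (r + r) + suc (r + r)
      ∎)
    where
    open ≲-Reasoning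
    d = suc d′
    s = r + d
    N = n + n + suc (suc d′)
    r≢s : r ≢ s
    r≢s = <⇒≢ (m<m+n r (s≤s z≤n))
    2r≤N : r + r ≤ N
    2r≤N = ≤-trans (+-mono-≤ r≤n′ r≤n′) (m≤m+n (n + n) (suc (suc d′)))
      where r≤n′ = r≤n r (≤-trans (s≤s z≤n) (≤-reflexive (sym δ≡)))
    e₁ : ∀ a b c → a + b + c ≡ (a + c) + b
    e₁ = solve-∀
    e₂ : ∀ X d a b → (X + d) + (a + b) ≡ (a + b + X) + d
    e₂ = solve-∀
    e₃ : ∀ n d′ → n + n + 2 + suc d′ ≡ suc (n + n + suc (suc d′))
    e₃ = solve-∀

  Δ-part : ∀ r d → 1 ≤ r → δ r ≡ suc d → sumRange (entries r) r d + entries+slack r (r + d) ≲ rowBound n r (suc d)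
  Δ-part r zero     = Δ-part-single r
  Δ-part r (suc d′) = Δ-part-long r d′

  δ≡0⇒1≤i : ∀ i → suc i ≤ L → δ (suc i) ≡ 0 → 1 ≤ i
  δ≡0⇒1≤i zero    i<L δ≡0 = ⊥-elim (<⇒≢ (lam-pos 0 i<L) (sym (trans (sym (δ₁≡lam₁ (ℓ≥1 i<L))) δ≡0)))
  δ≡0⇒1≤i (suc _) _   _   = s≤s z≤n

  row-inflow-outer : ∀ i → suc i ≤ L → δ (suc i) ≡ 0 →
                     entriesOfRow (suc i) + tailSlack (suc i) ≲ tailRightSlack (suc i) + upSlackUnderOuter i
  row-inflow-outer i i<L δ≡0 = begin
    entriesOfRow r + tailSlack r                                 ≡⟨ cong (entriesOfRow r +_) tail≡ ⟩
    sumRange (entries r) r (lam r) + sumRange (slack r) r (lam r) ≡⟨ sumRange-+ (entries r) (slack r) r (lam r) ⟨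
    sumRange (entries+slack r) r (lam r)                         ≡⟨ cong (sumRange (entries+slack r) r) lam≡ ⟩
    sumRange (entries+slack r) r (suc m)                         ≲⟨ outer-row i m i≥1 lam≡ δ≡0 ⟩
    sumRange (rightSlack r) r m + sumRange (upSlack i) r (suc m) ≡⟨ cong₂ _+_ tailRight≡ under≡ ⟨
    tailRightSlack r + upSlackUnderOuter i                       ∎
    where
    open ≲-Reasoning
    r = suc i
    m = lam r ∸ 1
    lam≡ : lam r ≡ suc m
    lam≡ = sym (m+[n∸m]≡n (lam-pos i i<L))
    i≥1 : 1 ≤ i
    i≥1 = δ≡0⇒1≤i i i<L δ≡0
    start≡ : tailStart Δ r ≡ r
    start≡ = trans (cong (λ t → r + (t ∸ 1)) δ≡0) (+-identityʳ r)
    tail≡ : tailSlack r ≡ sumRange (slack r) r (lam r)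
    tail≡ = cong₂ (sumRange (slack r)) start≡ (cong (λ t → lam r ∸ (t ∸ 1)) δ≡0)
    tailRight≡ : tailRightSlack r ≡ sumRange (rightSlack r) r m
    tailRight≡ = cong₂ (sumRange (rightSlack r)) start≡ (trans (cong (λ t → lam r ∸ (t ∸ 1) ∸ 1) δ≡0) (cong (_∸ 1) lam≡))
    under≡ : upSlackUnderOuter i ≡ sumRange (upSlack i) r (suc m)
    under≡ = cong₂ (sumRange (upSlack i)) (trans (cong (r +_) δ≡0) (+-identityʳ r)) (trans (cong (lam r ∸_) δ≡0) lam≡)

  outer-afterΔ : ∀ i d → suc i ≤ L → δ (suc i) ≡ suc d →
                 sumRange (entries+slack (suc i)) (suc (suc i + d)) (lam (suc i) ∸ suc d) ≲
                 sumRange (rightSlack (suc i)) (suc i + d) (lam (suc i) ∸ suc d) +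
                 sumRange (upSlack i) (suc (suc i + d)) (lam (suc i) ∸ suc d)
  outer-afterΔ zero d 1≤L δ≡ = subst (λ t → sumRange (entries+slack 1) (2 + d) t ≲
                                              sumRange (rightSlack 1) (1 + d) t + sumRange (upSlack 0) (2 + d) t)
                                  (sym k≡0) ≲-refl
    where
    k≡0 : lam 1 ∸ suc d ≡ 0
    k≡0 = trans (cong (lam 1 ∸_) (trans (sym δ≡) (δ₁≡lam₁ (ℓ≥1 1≤L)))) (n∸n≡0 (lam 1))
  outer-afterΔ (suc i) d i<L δ≡ = outer-run (suc i) (r + d) k (s≤s z≤n) (m≤m+n r d) end (≤-reflexive (trans (cong (r +_) δ≡) (+-suc r d)))
    where
    r = suc (suc i)
    k = lam r ∸ suc d
    end : suc (r + d) + k ≤ r + lam r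
    end = ≤-reflexive (trans (cong (_+ k) (sym (+-suc r d)))
            (trans (+-assoc r (suc d) k) (cong (r +_) (m+[n∸m]≡n (subst (_≤ lam r) δ≡ (δ≤lam r))))))

  row-inflow-Δ : ∀ i d → suc i ≤ L → δ (suc i) ≡ suc d →
                 entriesOfRow (suc i) + tailSlack (suc i) ≲ rowBound n (suc i) (suc d) + tailRightSlack (suc i) + upSlackUnderOuter i
  row-inflow-Δ i d i<L δ≡ = begin
    entriesOfRow r + tailSlack r
      ≡⟨ cong₂ _+_ row≡ tail≡ ⟩
    (sumRange (entries r) r d + (entries r s + sumRange (entries r) (suc s) k)) + (slack r s + sumRange (slack r) (suc s) k)
      ≡⟨ regroup (sumRange (entries r) r d) (entries r s) (sumRange (entries r) (suc s) k) (slack r s) (sumRange (slack r) (suc s) k) ⟩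
    (sumRange (entries r) r d + entries+slack r s) + (sumRange (entries r) (suc s) k + sumRange (slack r) (suc s) k)
      ≡⟨ cong ((sumRange (entries r) r d + entries+slack r s) +_) (sumRange-+ (entries r) (slack r) (suc s) k) ⟨
    (sumRange (entries r) r d + entries+slack r s) + sumRange (entries+slack r) (suc s) k
      ≲⟨ +-mono-≲ (Δ-part r d (s≤s z≤n) δ≡) (outer-afterΔ i d i<L δ≡) ⟩
    rowBound n r (suc d) + (sumRange (rightSlack r) s k + sumRange (upSlack i) (suc s) k)
      ≡⟨ cong₂ (λ a b → rowBound n r (suc d) + (a + b)) tailRight≡ under≡ ⟨
    rowBound n r (suc d) + (tailRightSlack r + upSlackUnderOuter i)
      ≡⟨ +-assoc (rowBound n r (suc d)) (tailRightSlack r) (upSlackUnderOuter i) ⟨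
    rowBound n r (suc d) + tailRightSlack r + upSlackUnderOuter i
      ∎
    where
    open ≲-Reasoning
    r = suc i
    s = r + d
    k = lam r ∸ suc d
    d+k : suc d + k ≡ lam r
    d+k = m+[n∸m]≡n (subst (_≤ lam r) δ≡ (δ≤lam r))
    lam≡ : lam r ≡ d + suc k
    lam≡ = trans (sym d+k) (sym (+-suc d k))
    regroup : ∀ a b c p q → (a + (b + c)) + (p + q) ≡ (a + (b + p)) + (c + q)
    regroup = solve-∀
    row≡ : entriesOfRow r ≡ sumRange (entries r) r d + (entries r s + sumRange (entries r) (suc s) k)
    row≡ = trans (cong (sumRange (entries r) r) lam≡) (sumRange-split (entries r) r d (suc k))
    start≡ : tailStart Δ r ≡ s
    start≡ = cong (λ t → r + (t ∸ 1)) δ≡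
    length≡ : tailLength la Δ r ≡ suc k
    length≡ = trans (cong (λ t → lam r ∸ (t ∸ 1)) δ≡) (trans (cong (_∸ d) lam≡) (m+n∸m≡n d (suc k)))
    tail≡ : tailSlack r ≡ slack r s + sumRange (slack r) (suc s) k
    tail≡ = cong₂ (sumRange (slack r)) start≡ length≡
    tailRight≡ : tailRightSlack r ≡ sumRange (rightSlack r) s k
    tailRight≡ = cong₂ (sumRange (rightSlack r)) start≡ (cong (_∸ 1) length≡)
    under≡ : upSlackUnderOuter i ≡ sumRange (upSlack i) (suc s) k
    under≡ = cong₂ (sumRange (upSlack i)) (trans (cong (r +_) δ≡) (+-suc r d)) (cong (lam r ∸_) δ≡)

  row-inflow : ∀ i → suc i ≤ L →
               entriesOfRow (suc i) + tailSlack (suc i) ≲ rowBound n (suc i) (δ (suc i)) + tailRightSlack (suc i) + upSlackUnderOuter i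
  row-inflow i i<L = by-δ (δ (suc i)) refl
    where
    by-δ : ∀ d → δ (suc i) ≡ d →
           entriesOfRow (suc i) + tailSlack (suc i) ≲ rowBound n (suc i) d + tailRightSlack (suc i) + upSlackUnderOuter i
    by-δ zero    δ≡ = row-inflow-outer i i<L δ≡
    by-δ (suc d) δ≡ = row-inflow-Δ i d i<L δ≡

  tailStart≤outerStart : ∀ i → 1 ≤ outerLength la Δ (suc (suc i)) → tailStart Δ (suc i) ≤ outerStart Δ (suc (suc i))
  tailStart≤outerStart i outer≥1 = ≤-trans (+-monoʳ-≤ r δ∸1≤) (≤-reflexive (+-suc r (δ (suc r))))
    where
    r = suc i
    δ<lam : δ (suc r) < lam (suc r)
    δ<lam = m∸n≢0⇒n<m {lam (suc r)} {δ (suc r)} (λ e → <⇒≱ outer≥1 (≤-reflexive e))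
    δ∸1≤ : δ r ∸ 1 ≤ suc (δ (suc r))
    δ∸1≤ with suc r ≤? ℓ
    ... | yes r<ℓ = ≤-trans (∸-monoˡ-≤ 1 (δ-tight i r<ℓ δ<lam)) (≤-reflexive (trans (+-∸-assoc (δ (suc r)) {2} {1} (s≤s z≤n)) (+-comm _ 1)))
    ... | no r≮ℓ = subst (λ t → δ r ∸ 1 ≤ suc t) (sym (δ-beyond (≰⇒> r≮ℓ))) δ∸1≤1
      where
      δ∸1≤1 : δ r ∸ 1 ≤ 1
      δ∸1≤1 with r ≤? ℓ
      ... | yes r≤ℓ = ∸-monoˡ-≤ 1 (subst (λ t → δ t ≤ 2) (sym r≡ℓ)
                        (δ-last≤2 (subst (λ t → suc t ≤ L) r≡ℓ (lam-in (suc r) (≤-trans (s≤s z≤n) δ<lam)))))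
        where
        r≡ℓ : r ≡ ℓ
        r≡ℓ = ≤-antisym r≤ℓ (≤-pred (≰⇒> r≮ℓ))
      ... | no r≰ℓ = subst (λ t → t ∸ 1 ≤ 1) (sym (δ-beyond (≰⇒> r≰ℓ))) z≤n

  upSlackOff : ℕ → ℕ → ℕ
  upSlackOff r j = offDiagonal r j (upSlack r j)

  tailRightSlack≲ : ∀ i → suc i ≤ L → tailRightSlack (suc i) ≲ sumRange (rightSlack (suc i)) (tailStart Δ (suc i)) (tailLength la Δ (suc i))
  tailRightSlack≲ i i<L = begin
    sumRange (rightSlack r) a m                      ≡⟨ +-identityʳ _ ⟨
    sumRange (rightSlack r) a m + 0                  ≲⟨ +-mono-≲ ≲-refl (rightSlack-rowEnd r (s≤s z≤n) i<L) ⟩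
    sumRange (rightSlack r) a m + rightSlack r (r + lam r ∸ 1) ≡⟨ cong (λ t → sumRange (rightSlack r) a m + rightSlack r t) last≡ ⟨
    sumRange (rightSlack r) a m + rightSlack r (a + m) ≡⟨ sumRange-last (rightSlack r) a m ⟨
    sumRange (rightSlack r) a (suc m)                ≡⟨ cong (sumRange (rightSlack r) a) length≡ ⟨
    sumRange (rightSlack r) a (tailLength la Δ r)    ∎
    where
    open ≲-Reasoning
    r = suc i
    a = tailStart Δ r
    m = tailLength la Δ r ∸ 1
    length≡ : tailLength la Δ r ≡ suc m
    length≡ = sym (m+[n∸m]≡n {1} (m<n⇒0<n∸m (≤-trans (s≤s (∸-monoˡ-≤ 1 (δ≤lam r))) (≤-reflexive (m+[n∸m]≡n {1} (lam-pos i i<L))))))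
    last≡ : a + m ≡ r + lam r ∸ 1
    last≡ = cong (_∸ 1) (trans (sym (+-suc a m)) (trans (cong (a +_) (sym length≡)) (tailStart+tailLength r)))

  upSlackUnderOuter≲ : ∀ i → suc i ≤ L → upSlackUnderOuter (suc i) ≲ sumRange (upSlackOff (suc i)) (tailStart Δ (suc i)) (tailLength la Δ (suc i))
  upSlackUnderOuter≲ i i<L with 1 ≤? outerLength la Δ (suc (suc i))
  ... | no outer≱1 = ≲-trans (≲-reflexive (cong (sumRange (upSlack r) (outerStart Δ (suc r))) outer≡0))
                       (0≲sumRange (upSlackOff r) a (tailLength la Δ r) (λ j j∈ → upSlack-unused r j (s≤s z≤n) i<L j∈ (notOuter j)))
    where
    r = suc i
    a = tailStart Δ r
    outer≡0 : outerLength la Δ (suc r) ≡ 0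
    outer≡0 = n<1⇒n≡0 (≰⇒> outer≱1)
    notOuter : ∀ j → ¬ InRange (outerStart Δ (suc r)) (outerLength la Δ (suc r)) j
    notOuter j (b≤j , j<) = <⇒≱ (subst (j <_) (trans (cong (outerStart Δ (suc r) +_) outer≡0) (+-identityʳ _)) j<) b≤j
  ... | yes outer≥1 = begin
    sumRange (upSlack r) b k      ≡⟨ sumRange-cong b k (λ j j∈ → sym (offDiagonal-off (upSlack r j) (<⇒≢ (r<j j j∈)))) ⟩
    sumRange (upSlackOff r) b k   ≲⟨ sumRange-subrange (upSlackOff r) a (tailLength la Δ r) b k a≤b b+k≤
                                       (λ j → upSlack-unused r j (s≤s z≤n) i<L) ⟩
    sumRange (upSlackOff r) a (tailLength la Δ r) ∎
    where
    open ≲-Reasoning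
    r = suc i
    a = tailStart Δ r
    b = outerStart Δ (suc r)
    k = outerLength la Δ (suc r)
    r<j : ∀ j → InRange b k j → r < j
    r<j j (b≤j , _) = <-≤-trans (n<1+n r) (≤-trans (m≤m+n (suc r) (δ (suc r))) b≤j)
    a≤b : a ≤ b
    a≤b = tailStart≤outerStart i outer≥1
    b+k≤ : b + k ≤ a + tailLength la Δ r
    b+k≤ = subst₂ _≤_ (sym (outerStart+outerLength (suc r))) (sym (tailStart+tailLength r))
             (≤-trans (≤-reflexive (sym (+-suc r (lam (suc r)))))
               (+-monoʳ-≤ r (lam-strict r (s≤s z≤n) (≤-trans (s≤s z≤n) δ<lam))))
      where
      δ<lam : δ (suc r) < lam (suc r)
      δ<lam = m∸n≢0⇒n<m {lam (suc r)} {δ (suc r)} (λ e → <⇒≱ outer≥1 (≤-reflexive e))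

  row-outflow : ∀ i → suc i ≤ L → tailRightSlack (suc i) + upSlackUnderOuter (suc i) ≲ tailSlack (suc i)
  row-outflow i i<L = begin
    tailRightSlack r + upSlackUnderOuter r
      ≲⟨ +-mono-≲ (tailRightSlack≲ i i<L) (upSlackUnderOuter≲ i i<L) ⟩
    sumRange (rightSlack r) (tailStart Δ r) (tailLength la Δ r) + sumRange (upSlackOff r) (tailStart Δ r) (tailLength la Δ r)
      ≡⟨ sumRange-+ (rightSlack r) (upSlackOff r) (tailStart Δ r) (tailLength la Δ r) ⟨
    tailSlack r
      ∎
    where
    open ≲-Reasoning
    r = suc i

  upSlackUnderOuter-shift : sumRange (λ r → upSlackUnderOuter (pred r)) 1 L ≡ sumRange upSlackUnderOuter 1 L
  upSlackUnderOuter-shift with L in L≡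
  ... | zero  = refl
  ... | suc m = begin
    sumRange (λ r → U (pred r)) 1 (suc m) ≡⟨ sumRange-suc (U ∘ pred) 0 (suc m) ⟩
    U 0 + sumRange U 1 m                   ≡⟨ cong (_+ sumRange U 1 m) U0≡0 ⟩
    sumRange U 1 m                         ≡⟨ +-identityʳ (sumRange U 1 m) ⟨
    sumRange U 1 m + 0                     ≡⟨ cong (sumRange U 1 m +_) ULast≡0 ⟨
    sumRange U 1 m + U (1 + m)             ≡⟨ sumRange-last U 1 m ⟨
    sumRange U 1 (suc m)                   ∎
    where
    open ≡-Reasoning
    U = upSlackUnderOuter
    U0≡0 : U 0 ≡ 0
    U0≡0 = cong (sumRange (upSlack 0) (outerStart Δ 1))
             (trans (cong (lam 1 ∸_) (δ₁≡lam₁ (ℓ≥1 (subst (1 ≤_) (sym L≡) (s≤s z≤n))))) (n∸n≡0 (lam 1)))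
    ULast≡0 : U (suc m) ≡ 0
    ULast≡0 = cong (sumRange (upSlack (suc m)) (outerStart Δ (suc (suc m))))
                (trans (cong (_∸ δ (suc (suc m))) (lam-beyond (s≤s (≤-reflexive L≡)))) (0∸n≡0 (δ (suc (suc m)))))

  entries≲rowBounds : sumRange entriesOfRow 1 L ≲ sumRange (λ r → rowBound n r (δ r)) 1 L
  entries≲rowBounds = +-cancelʳ-≲ _ _ (sumRange tailSlack 1 L) (begin
    sumRange entriesOfRow 1 L + sumRange tailSlack 1 L
      ≡⟨ sumRange-+ entriesOfRow tailSlack 1 L ⟨
    sumRange (λ r → entriesOfRow r + tailSlack r) 1 L
      ≲⟨ sumRange-mono-≲ 1 L (λ { zero (() , _) ; (suc i) j∈ → row-inflow i (≤-pred (proj₂ j∈)) }) ⟩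
    sumRange (λ r → b r + tailRightSlack r + upSlackUnderOuter (pred r)) 1 L
      ≡⟨ sumRange-+ (λ r → b r + tailRightSlack r) (λ r → upSlackUnderOuter (pred r)) 1 L ⟩
    sumRange (λ r → b r + tailRightSlack r) 1 L + sumRange (λ r → upSlackUnderOuter (pred r)) 1 L
      ≡⟨ cong₂ _+_ (sumRange-+ b tailRightSlack 1 L) upSlackUnderOuter-shift ⟩
    sumRange b 1 L + sumRange tailRightSlack 1 L + sumRange upSlackUnderOuter 1 L
      ≡⟨ +-assoc (sumRange b 1 L) (sumRange tailRightSlack 1 L) (sumRange upSlackUnderOuter 1 L) ⟩
    sumRange b 1 L + (sumRange tailRightSlack 1 L + sumRange upSlackUnderOuter 1 L)
      ≡⟨ cong (sumRange b 1 L +_) (sumRange-+ tailRightSlack upSlackUnderOuter 1 L) ⟨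
    sumRange b 1 L + sumRange (λ r → tailRightSlack r + upSlackUnderOuter r) 1 L
      ≲⟨ +-mono-≲ ≲-refl (sumRange-mono-≲ 1 L (λ { zero (() , _) ; (suc i) j∈ → row-outflow i (≤-pred (proj₂ j∈)) })) ⟩
    sumRange b 1 L + sumRange tailSlack 1 L
      ∎)
    where
    open ≲-Reasoning
    b : ℕ → ℕ
    b r = rowBound n r (δ r)

rowEntries≡sumRange : ∀ (T : ℕ → ℕ → Filling) i j m → rowEntries T i j m ≡ sumRange (λ j → length (T i j)) j m
rowEntries≡sumRange T i j zero    = refl
rowEntries≡sumRange T i j (suc m) = cong (length (T i j) +_) (rowEntries≡sumRange T i (suc j) m)

entriesFrom≡sumRange : ∀ (T : ℕ → ℕ → Filling) k xs →
                       entriesFrom T (suc k) xs ≡ sumRange (λ r → rowEntries T r r (part xs (r ∸ k))) (suc k) (length xs)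
entriesFrom≡sumRange T k []       = refl
entriesFrom≡sumRange T k (x ∷ xs) = cong₂ _+_ (cong (rowEntries T (suc k) (suc k)) (cong (part (x ∷ xs)) (sym (m+n∸n≡m 1 k))))
  (trans (entriesFrom≡sumRange T (suc k) xs)
    (sumRange-cong (suc (suc k)) (length xs) (λ r r∈ → cong (rowEntries T r r) (part-shift r (proj₁ r∈)))))
  where
  part-shift : ∀ r → suc (suc k) ≤ r → part xs (r ∸ suc k) ≡ part (x ∷ xs) (r ∸ k)
  part-shift r k<r = sym (trans (cong (part (x ∷ xs)) (+-∸-assoc 1 (<⇒≤ k<r)))
                       (part-cons x xs (m<n⇒0<n∸m k<r)))

degT≡sumRange : ∀ la (T : ℕ → ℕ → Filling) →
                degT la T ≡ sumRange (λ r → sumRange (λ j → length (T r j)) r (part la r)) 1 (length la)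
degT≡sumRange la T = trans (entriesFrom≡sumRange T 0 la)
  (sumRange-cong 1 (length la) (λ r _ → rowEntries≡sumRange T r r (part la r)))

module UpperBound (la : List ℕ) (sp : StrictPartition la) (Δ : List ℕ) (isL : IsLargestDPartitionIn Δ la)
                  (n : ℕ) (L≤n : length la ≤ n) (T : ℕ → ℕ → Filling) (isT : IsPSVT la n T) where

  open Tableau n la sp T isT

  localBounds : LocalBounds ≤-additivePreorder la Δ n
  localBounds = record
    { entries           = entries
    ; rightSlack        = rightSlack
    ; upSlack           = upSlack
    ; least             = least
    ; inΔ-step          = λ r j h h→ _ → entries+leastCode≤-right r j h h→
    ; lastΔ-offDiag     = λ r j h r≢j _ → entries+slack+leastCode≤-offDiag r j h r≢j
    ; lastΔ-diag        = λ r h _ → entries+slack+idx≤-diag r h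
    ; firstΔ-leastCode  = λ r h _ → 1+2i≤leastCode-diag r h
    ; firstΔ-leastIdx   = λ r h _ → i≤idx-least-diag r h
    ; outer-offDiag     = λ i j hC h← h↓ i≢j _ → entries+slack≤-offDiag i j hC h← h↓ i≢j
    ; outer-diag        = λ i hC h↓ _ → entries+slack≤-diag i hC h↓
    ; rightSlack-rowEnd = λ _ _ _ → z≤n
    ; upSlack-unused    = λ _ _ _ _ _ _ → z≤n
    }

  degT≤ : degT la T ≤ sumRange (λ r → rowBound n r (part Δ r)) 1 (length la)
  degT≤ = subst (_≤ _) (sym (degT≡sumRange la T))
            (SlackArgument.entries≲rowBounds la sp Δ isL n L≤n ≤-additivePreorder localBounds)

e+c+d≡a+b⇒ℤ : ∀ e a b c d → e + c + d ≡ a + b → ℤ.+ e ≡ ℤ.+ a ℤ.+ ℤ.+ b ℤ.- ℤ.+ c ℤ.- ℤ.+ d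
e+c+d≡a+b⇒ℤ e a b c d eq = trans (sym (cancel (ℤ.+ e) (ℤ.+ c) (ℤ.+ d))) (cong (λ t → t ℤ.- ℤ.+ c ℤ.- ℤ.+ d) (cong ℤ.+_ eq))
  where
  cancel : ∀ (E C D : ℤ) → E ℤ.+ C ℤ.+ D ℤ.- C ℤ.- D ≡ E
  cancel = ℤ-Solver.solve-∀

module RowBoundSum (la : List ℕ) (sp : StrictPartition la) (Δ : List ℕ) (isL : IsLargestDPartitionIn Δ la)
                   (n : ℕ) (L≤n : length la ≤ n) (L≥1 : 1 ≤ length la) where

  open LargestDPartition la sp Δ isL

  b g : ℕ → ℕ
  b r = rowBound n r (δ r)
  g r = n + n + δ r ∸ (r + r)

  ℓ≥1′ : 1 ≤ ℓ
  ℓ≥1′ = ℓ≥1 L≥1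

  ℓ≤n : ℓ ≤ n
  ℓ≤n = ≤-trans ℓ≤L L≤n

  sumRange-g : ∀ m → m ≤ n → sumRange g 1 m + m * suc m ≡ (n + n) * m + sumRange δ 1 m
  sumRange-g zero    _   = sym (trans (+-identityʳ ((n + n) * 0)) (*-zeroʳ (n + n)))
  sumRange-g (suc m) m<n = begin
    sumRange g 1 (suc m) + suc m * suc (suc m)                  ≡⟨ cong (_+ suc m * suc (suc m)) (sumRange-last g 1 m) ⟩
    sumRange g 1 m + g (suc m) + suc m * suc (suc m)            ≡⟨ e₁ (sumRange g 1 m) (g (suc m)) m ⟩
    (sumRange g 1 m + m * suc m) + (g (suc m) + (suc m + suc m)) ≡⟨ cong₂ _+_ (sumRange-g m (<⇒≤ m<n)) g+2r ⟩
    ((n + n) * m + sumRange δ 1 m) + (n + n + δ (suc m))          ≡⟨ e₂ n m (sumRange δ 1 m) (δ (suc m)) ⟩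
    (n + n) * suc m + (sumRange δ 1 m + δ (1 + m))                ≡⟨ cong ((n + n) * suc m +_) (sumRange-last δ 1 m) ⟨
    (n + n) * suc m + sumRange δ 1 (suc m)                        ∎
    where
    open ≡-Reasoning
    e₁ : ∀ A G m → A + G + suc m * suc (suc m) ≡ (A + m * suc m) + (G + (suc m + suc m))
    e₁ = solve-∀
    e₂ : ∀ n m S d → ((n + n) * m + S) + (n + n + d) ≡ (n + n) * suc m + (S + d)
    e₂ = solve-∀
    g+2r : g (suc m) + (suc m + suc m) ≡ n + n + δ (suc m)
    g+2r = m∸n+n≡m (≤-trans (+-mono-≤ m<n m<n) (m≤m+n (n + n) (δ (suc m))))

  sumRange-g-ℓ : sumRange g 1 ℓ + ℓ * suc ℓ ≡ (n + n) * ℓ + size Δ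
  sumRange-g-ℓ = trans (sumRange-g ℓ ℓ≤n) (cong ((n + n) * ℓ +_) (sym (sum≡sumRange-part Δ)))

  b≡g : ∀ r d → δ r ≡ suc (suc d) → b r ≡ g r
  b≡g r d δ≡ = trans (cong (rowBound n r) δ≡) (cong (λ t → n + n + t ∸ (r + r)) (sym δ≡))

  δ≥2-below-ℓ : ∀ r → 1 ≤ r → suc r ≤ ℓ → Σ ℕ (λ d → δ r ≡ suc (suc d))
  δ≥2-below-ℓ (suc r) _ r<ℓ = δ (suc r) ∸ 2 , sym (m+[n∸m]≡n (≤-trans (m≤n+m 2 _) (δ-gap r r<ℓ)))

  ℓ′ : ℕ
  ℓ′ = ℓ ∸ 1

  1+ℓ′≡ℓ : suc ℓ′ ≡ ℓ
  1+ℓ′≡ℓ = m+[n∸m]≡n ℓ≥1′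

  sumRange-b : sumRange b 1 (length la) ≡ sumRange g 1 ℓ′ + b ℓ
  sumRange-b = begin
    sumRange b 1 L                          ≡⟨ cong (sumRange b 1) (m+[n∸m]≡n ℓ≤L) ⟨
    sumRange b 1 (ℓ + (L ∸ ℓ))              ≡⟨ sumRange-split b 1 ℓ (L ∸ ℓ) ⟩
    sumRange b 1 ℓ + sumRange b (1 + ℓ) (L ∸ ℓ) ≡⟨ cong (sumRange b 1 ℓ +_) beyond≡0 ⟩
    sumRange b 1 ℓ + 0                      ≡⟨ +-identityʳ _ ⟩
    sumRange b 1 ℓ                          ≡⟨ cong (sumRange b 1) 1+ℓ′≡ℓ ⟨
    sumRange b 1 (suc ℓ′)                   ≡⟨ sumRange-last b 1 ℓ′ ⟩
    sumRange b 1 ℓ′ + b (1 + ℓ′)            ≡⟨ cong₂ _+_ (sumRange-cong 1 ℓ′ early) (cong b 1+ℓ′≡ℓ) ⟩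
    sumRange g 1 ℓ′ + b ℓ                   ∎
    where
    open ≡-Reasoning
    beyond≡0 : sumRange b (1 + ℓ) (L ∸ ℓ) ≡ 0
    beyond≡0 = sumRange-zero b (1 + ℓ) (L ∸ ℓ) (λ r r∈ → cong (rowBound n r) (δ-beyond (proj₁ r∈)))
    early : ∀ r → InRange 1 ℓ′ r → b r ≡ g r
    early r (1≤r , r<) = b≡g r _ (proj₂ (δ≥2-below-ℓ r 1≤r (subst (suc r ≤_) 1+ℓ′≡ℓ r<)))

  sumRange-g-split : sumRange g 1 ℓ ≡ sumRange g 1 ℓ′ + g ℓ
  sumRange-g-split = trans (cong (sumRange g 1) (sym 1+ℓ′≡ℓ)) (trans (sumRange-last g 1 ℓ′) (cong (λ t → sumRange g 1 ℓ′ + g t) 1+ℓ′≡ℓ))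

  sumRange-b-δℓ≥2 : ∀ d → δ ℓ ≡ suc (suc d) → sumRange b 1 L + ℓ * ℓ + ℓ ≡ size Δ + 2 * n * ℓ
  sumRange-b-δℓ≥2 d δ≡ = begin
    sumRange b 1 L + ℓ * ℓ + ℓ          ≡⟨ cong (λ t → t + ℓ * ℓ + ℓ) (trans sumRange-b (cong (sumRange g 1 ℓ′ +_) (b≡g ℓ d δ≡))) ⟩
    sumRange g 1 ℓ′ + g ℓ + ℓ * ℓ + ℓ   ≡⟨ cong (λ t → t + ℓ * ℓ + ℓ) sumRange-g-split ⟨
    sumRange g 1 ℓ + ℓ * ℓ + ℓ          ≡⟨ e₁ (sumRange g 1 ℓ) ℓ ⟩
    sumRange g 1 ℓ + ℓ * suc ℓ          ≡⟨ sumRange-g-ℓ ⟩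
    (n + n) * ℓ + size Δ                ≡⟨ e₂ n ℓ (size Δ) ⟩
    size Δ + 2 * n * ℓ                  ∎
    where
    open ≡-Reasoning
    e₁ : ∀ a l → a + l * l + l ≡ a + l * suc l
    e₁ = solve-∀
    e₂ : ∀ n l s → (n + n) * l + s ≡ s + 2 * n * l
    e₂ = solve-∀

  sumRange-b-δℓ≡1 : δ ℓ ≡ 1 → sumRange b 1 L + ℓ * ℓ + n ≡ size Δ + 2 * n * ℓ
  sumRange-b-δℓ≡1 δ≡ = begin
    sumRange b 1 L + ℓ * ℓ + n                              ≡⟨ cong (λ t → t + ℓ * ℓ + n) (trans sumRange-b (cong (sumRange g 1 ℓ′ +_) bℓ≡)) ⟩
    sumRange g 1 ℓ′ + (u + 1) + ℓ * ℓ + n                   ≡⟨ cong (sumRange g 1 ℓ′ + (u + 1) + ℓ * ℓ +_) u+ℓ≡n ⟨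
    sumRange g 1 ℓ′ + (u + 1) + ℓ * ℓ + (u + ℓ)             ≡⟨ e₁ (sumRange g 1 ℓ′) u ℓ ⟩
    sumRange g 1 ℓ′ + (u + u + 1) + ℓ * suc ℓ               ≡⟨ cong (λ t → sumRange g 1 ℓ′ + t + ℓ * suc ℓ) gℓ≡ ⟨
    sumRange g 1 ℓ′ + g ℓ + ℓ * suc ℓ                       ≡⟨ cong (_+ ℓ * suc ℓ) sumRange-g-split ⟨
    sumRange g 1 ℓ + ℓ * suc ℓ                              ≡⟨ sumRange-g-ℓ ⟩
    (n + n) * ℓ + size Δ                                    ≡⟨ e₂ n ℓ (size Δ) ⟩
    size Δ + 2 * n * ℓ                                      ∎
    where
    open ≡-Reasoning
    u = n ∸ ℓ
    u+ℓ≡n : u + ℓ ≡ n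
    u+ℓ≡n = m∸n+n≡m ℓ≤n
    bℓ≡ : b ℓ ≡ u + 1
    bℓ≡ = trans (cong (rowBound n ℓ) δ≡) (+-∸-comm 1 ℓ≤n)
    e₁ : ∀ S u l → S + (u + 1) + l * l + (u + l) ≡ S + (u + u + 1) + l * suc l
    e₁ = solve-∀
    e₂ : ∀ n l s → (n + n) * l + s ≡ s + 2 * n * l
    e₂ = solve-∀
    e₃ : ∀ u l → u + u + 1 + (l + l) ≡ (u + l) + (u + l) + 1
    e₃ = solve-∀
    gℓ≡ : g ℓ ≡ u + u + 1
    gℓ≡ = +-cancelʳ-≡ (ℓ + ℓ) (g ℓ) (u + u + 1) (trans
            (trans (m∸n+n≡m (≤-trans (+-mono-≤ ℓ≤n ℓ≤n) (m≤m+n (n + n) (δ ℓ)))) (cong (n + n +_) δ≡))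
            (sym (trans (e₃ u ℓ) (cong (λ t → t + t + 1) u+ℓ≡n))))

  sumRange-b≡degFormula : ℤ.+ (sumRange b 1 (length la)) ≡ degFormula n Δ
  sumRange-b≡degFormula = by-δℓ (δ ℓ) refl
    where
    by-δℓ : ∀ d → δ ℓ ≡ d → ℤ.+ (sumRange b 1 L) ≡ degFormula n Δ
    by-δℓ zero          δ≡ = ⊥-elim (<⇒≢ (subst (λ t → 1 ≤ δ t) 1+ℓ′≡ℓ (δ-pos ℓ′ (≤-reflexive 1+ℓ′≡ℓ))) (sym δ≡))
    by-δℓ (suc zero)    δ≡ rewrite trans (last≡part-length Δ ℓ≥1′) (cong just δ≡) =
      e+c+d≡a+b⇒ℤ (sumRange b 1 L) (size Δ) (2 * n * ℓ) (ℓ * ℓ) n (sumRange-b-δℓ≡1 δ≡)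
    by-δℓ (suc (suc d)) δ≡ rewrite trans (last≡part-length Δ ℓ≥1′) (cong just δ≡) =
      e+c+d≡a+b⇒ℤ (sumRange b 1 L) (size Δ) (2 * n * ℓ) (ℓ * ℓ) ℓ (sumRange-b-δℓ≥2 d δ≡)

-- Diagonal runs

InD? : ∀ la i j → Dec (InD la i j)
InD? la i j = (1 ≤? i) ×-dec ((i ≤? j) ×-dec (suc j ≤? i + part la i))

indicator : ∀ {P : Set} → Dec P → ℕ
indicator (yes _) = 1
indicator (no _)  = 0

indicator-yes : ∀ {P : Set} (d : Dec P) → P → indicator d ≡ 1
indicator-yes (yes _) _ = refl
indicator-yes (no ¬p) p = ⊥-elim (¬p p)

indicator-no : ∀ {P : Set} (d : Dec P) → ¬ P → indicator d ≡ 0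
indicator-no (yes p) ¬p = ⊥-elim (¬p p)
indicator-no (no _)  _  = refl

indicator≤1 : ∀ {P : Set} (d : Dec P) → indicator d ≤ 1
indicator≤1 (yes _) = s≤s z≤n
indicator≤1 (no _)  = z≤n

module DiagonalRuns (la : List ℕ) (sp : StrictPartition la) where

  open StrictShape la sp

  run : ℕ → ℕ → ℕ → ℕ
  run zero    i j = 0
  run (suc f) i j with InD? la (suc i) (suc j)
  ... | yes _ = suc (run f (suc i) (suc j))
  ... | no _  = 0

  -- Rows above L are empty, so L ∸ i steps suffice.
  κ : ℕ → ℕ → ℕ
  κ i j = run (L ∸ i) i j

  -- Whether the last box (i + κ, j + κ) of the run has a box above it, resp. to its right.
  above beside : ℕ → ℕ → ℕ
  above i j = indicator (InD? la (suc i + κ i j) (j + κ i j))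
  beside i j = indicator (InD? la (i + κ i j) (suc j + κ i j))

  κ-yes : ∀ i j → InD la (suc i) (suc j) → κ i j ≡ suc (κ (suc i) (suc j))
  κ-yes i j h = trans (cong (λ f → run f i j) (+-∸-assoc 1 (InD-row≤L h))) (unfold (L ∸ suc i))
    where
    unfold : ∀ f → run (suc f) i j ≡ suc (run f (suc i) (suc j))
    unfold f with InD? la (suc i) (suc j)
    ... | yes _ = refl
    ... | no ¬h = ⊥-elim (¬h h)

  κ-no : ∀ i j → ¬ InD la (suc i) (suc j) → κ i j ≡ 0
  κ-no i j ¬h = unfold (L ∸ i)
    where
    unfold : ∀ f → run f i j ≡ 0
    unfold zero = refl
    unfold (suc f) with InD? la (suc i) (suc j)
    ... | yes h = ⊥-elim (¬h h)
    ... | no _  = refl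

  above-yes : ∀ i j → InD la (suc i) (suc j) → above i j ≡ above (suc i) (suc j)
  above-yes i j h = cong₂ (λ a b → indicator (InD? la a b))
    (trans (cong (suc i +_) (κ-yes i j h)) (+-suc (suc i) _)) (trans (cong (j +_) (κ-yes i j h)) (+-suc j _))

  beside-yes : ∀ i j → InD la (suc i) (suc j) → beside i j ≡ beside (suc i) (suc j)
  beside-yes i j h = cong₂ (λ a b → indicator (InD? la a b))
    (trans (cong (i +_) (κ-yes i j h)) (+-suc i _)) (trans (cong (suc j +_) (κ-yes i j h)) (+-suc (suc j) _))

  above-no : ∀ i j → ¬ InD la (suc i) (suc j) → above i j ≡ indicator (InD? la (suc i) j)
  above-no i j ¬h = cong₂ (λ a b → indicator (InD? la a b))
    (trans (cong (suc i +_) (κ-no i j ¬h)) (+-identityʳ (suc i))) (trans (cong (j +_) (κ-no i j ¬h)) (+-identityʳ j))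

  beside-no : ∀ i j → ¬ InD la (suc i) (suc j) → beside i j ≡ indicator (InD? la i (suc j))
  beside-no i j ¬h = cong₂ (λ a b → indicator (InD? la a b))
    (trans (cong (i +_) (κ-no i j ¬h)) (+-identityʳ i)) (trans (cong (suc j +_) (κ-no i j ¬h)) (+-identityʳ (suc j)))

  above≤1 : ∀ i j → above i j ≤ 1
  above≤1 i j = indicator≤1 (InD? la (suc i + κ i j) (j + κ i j))

  private
    empty-above-L : ∀ {i j} → L ≤ i → ¬ InD la (suc i) j
    empty-above-L L≤i h = <⇒≱ (InD-row≤L h) L≤i

    L≤i+t : ∀ i {t} → L ≤ i + suc t → L ≤ suc i + t
    L≤i+t i {t} = subst (L ≤_) (+-suc i t)

    L≤i+0 : ∀ {i} → L ≤ i + 0 → L ≤ i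
    L≤i+0 {i} = subst (L ≤_) (+-identityʳ i)

    step-right : ∀ t i j → L ≤ i + t → InD la i (suc j) → i ≤ j → κ i j ≡ κ i (suc j) + above i (suc j)
    step-right t i j L≤ h i≤j with InD? la (suc i) (suc (suc j))
    step-right zero    i j L≤ h i≤j | yes h↗ = ⊥-elim (empty-above-L (L≤i+0 L≤) h↗)
    step-right (suc t) i j L≤ h i≤j | yes h↗ = begin
      κ i j                                         ≡⟨ κ-yes i j (InD-left (s≤s i≤j) h↗) ⟩
      suc (κ (suc i) (suc j))                       ≡⟨ cong suc (step-right t (suc i) (suc j) (L≤i+t i L≤) h↗ (s≤s i≤j)) ⟩
      suc (κ (suc i) (suc (suc j)) + above (suc i) (suc (suc j))) ≡⟨ cong₂ _+_ (κ-yes i (suc j) h↗) (above-yes i (suc j) h↗) ⟨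
      κ i (suc j) + above i (suc j)                 ∎
      where open ≡-Reasoning
    step-right t i j L≤ h i≤j | no ¬h↗ with InD? la (suc i) (suc j)
    ... | yes h↑ = trans (κ-yes i j h↑) (trans (cong suc (κ-no (suc i) (suc j) (¬h↗ ∘ InD-below (s≤s z≤n))))
                     (sym (cong₂ _+_ (κ-no i (suc j) ¬h↗) (trans (above-no i (suc j) ¬h↗) (indicator-yes (InD? la (suc i) (suc j)) h↑)))))
    ... | no ¬h↑ = trans (κ-no i j ¬h↑)
                     (sym (cong₂ _+_ (κ-no i (suc j) ¬h↗) (trans (above-no i (suc j) ¬h↗) (indicator-no (InD? la (suc i) (suc j)) ¬h↑))))

    step-up : ∀ t i j → L ≤ suc i + t → InD la (suc i) j → κ i j ≡ κ (suc i) j + beside (suc i) j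
    step-up t i j L≤ h with InD? la (suc (suc i)) (suc j)
    step-up zero    i j L≤ h | yes h↗ = ⊥-elim (empty-above-L (L≤i+0 L≤) h↗)
    step-up (suc t) i j L≤ h | yes h↗ = begin
      κ i j                                         ≡⟨ κ-yes i j (InD-below (s≤s z≤n) h↗) ⟩
      suc (κ (suc i) (suc j))                       ≡⟨ cong suc (step-up t (suc i) (suc j) (L≤i+t (suc i) L≤) h↗) ⟩
      suc (κ (suc (suc i)) (suc j) + beside (suc (suc i)) (suc j)) ≡⟨ cong₂ _+_ (κ-yes (suc i) j h↗) (beside-yes (suc i) j h↗) ⟨
      κ (suc i) j + beside (suc i) j                ∎
      where open ≡-Reasoning
    step-up t i j L≤ h | no ¬h↗ with InD? la (suc i) (suc j)
    ... | yes h→ = trans (κ-yes i j h→) (trans (cong suc (κ-no (suc i) (suc j) (¬h↗ ∘ InD-left (s≤s (proj₁ (proj₂ h))))))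
                     (sym (cong₂ _+_ (κ-no (suc i) j ¬h↗) (trans (beside-no (suc i) j ¬h↗) (indicator-yes (InD? la (suc i) (suc j)) h→)))))
    ... | no ¬h→ = trans (κ-no i j ¬h→)
                     (sym (cong₂ _+_ (κ-no (suc i) j ¬h↗) (trans (beside-no (suc i) j ¬h↗) (indicator-no (InD? la (suc i) (suc j)) ¬h→))))

    above+beside : ∀ t i j → L ≤ suc i + t → InD la (suc i) j → above i j + beside (suc i) j ≡ 1
    above+beside t i j L≤ h with InD? la (suc (suc i)) (suc j)
    above+beside zero    i j L≤ h | yes h↗ = ⊥-elim (empty-above-L (L≤i+0 L≤) h↗)
    above+beside (suc t) i j L≤ h | yes h↗ =
      trans (cong₂ _+_ (above-yes i j (InD-below (s≤s z≤n) h↗)) (beside-yes (suc i) j h↗)) (above+beside t (suc i) (suc j) (L≤i+t (suc i) L≤) h↗)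
    above+beside t i j L≤ h | no ¬h↗ with InD? la (suc i) (suc j)
    ... | yes h→ = cong₂ _+_ (trans (above-yes i j h→) (trans (above-no (suc i) (suc j) (¬h↗ ∘ InD-left (s≤s (proj₁ (proj₂ h)))))
                                 (indicator-no (InD? la (suc (suc i)) (suc j)) ¬h↗)))
                     (trans (beside-no (suc i) j ¬h↗) (indicator-yes (InD? la (suc i) (suc j)) h→))
    ... | no ¬h→ = cong₂ _+_ (trans (above-no i j ¬h→) (indicator-yes (InD? la (suc i) j) h))
                     (trans (beside-no (suc i) j ¬h↗) (indicator-no (InD? la (suc i) (suc j)) ¬h→))

    above-diag : ∀ t i → L ≤ i + t → above i i ≡ 0
    above-diag t i L≤ with InD? la (suc i) (suc i)
    above-diag zero    i L≤ | yes h↗ = ⊥-elim (empty-above-L (L≤i+0 L≤) h↗)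
    above-diag (suc t) i L≤ | yes h↗ = trans (above-yes i i h↗) (above-diag t (suc i) (L≤i+t i L≤))
    above-diag t i L≤ | no ¬h↗ = trans (above-no i i ¬h↗) (indicator-no (InD? la (suc i) i) (λ h → <-irrefl refl (proj₁ (proj₂ h))))

    run-end≤L : ∀ t i j → L ≤ i + t → InD la i j → i + κ i j + above i j ≤ L
    run-end≤L t i j L≤ h with InD? la (suc i) (suc j)
    run-end≤L zero    i j L≤ h | yes h↗ = ⊥-elim (empty-above-L (L≤i+0 L≤) h↗)
    run-end≤L (suc t) i j L≤ h | yes h↗ = subst (_≤ L)
      (sym (trans (cong₂ (λ a b → i + a + b) (κ-yes i j h↗) (above-yes i j h↗)) (cong (_+ above (suc i) (suc j)) (+-suc i (κ (suc i) (suc j))))))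
      (run-end≤L t (suc i) (suc j) (L≤i+t i L≤) h↗)
    run-end≤L t i j L≤ h | no ¬h↗ with InD? la (suc i) j
    ... | yes h↑ = subst (_≤ L) (sym (trans (cong₂ (λ a b → i + a + b) (κ-no i j ¬h↗) (trans (above-no i j ¬h↗) (indicator-yes (InD? la (suc i) j) h↑)))
                     (trans (cong (_+ 1) (+-identityʳ i)) (+-comm i 1)))) (InD-row≤L h↑)
    ... | no ¬h↑ = subst (_≤ L) (sym (trans (cong₂ (λ a b → i + a + b) (κ-no i j ¬h↗) (trans (above-no i j ¬h↗) (indicator-no (InD? la (suc i) j) ¬h↑)))
                     (trans (+-identityʳ _) (+-identityʳ i)))) (InD-row≤L h)

  κ-step-right : ∀ i j → InD la i (suc j) → i ≤ j → κ i j ≡ κ i (suc j) + above i (suc j)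
  κ-step-right i j = step-right L i j (m≤n+m L i)

  κ-step-up : ∀ i j → InD la (suc i) j → κ i j ≡ κ (suc i) j + beside (suc i) j
  κ-step-up i j = step-up L i j (m≤n+m L (suc i))

  above+beside≡1 : ∀ i j → InD la (suc i) j → above i j + beside (suc i) j ≡ 1
  above+beside≡1 i j = above+beside L i j (m≤n+m L (suc i))

  above-diag≡0 : ∀ i → above i i ≡ 0
  above-diag≡0 i = above-diag L i (m≤n+m L i)

  i+κ+above≤L : ∀ i j → InD la i j → i + κ i j + above i j ≤ L
  i+κ+above≤L i j = run-end≤L L i j (m≤n+m L i)

  κ-rowEnd : ∀ i j → InD la i j → ¬ InD la i (suc j) → κ i j ≡ 0
  κ-rowEnd i j h ¬h→ = κ-no i j (¬h→ ∘ InD-below (proj₁ h))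

  κ,above-noUp : ∀ i j → i < j → ¬ InD la (suc i) j → κ i j ≡ 0 × above i j ≡ 0
  κ,above-noUp i j i<j ¬h↑ = κ-no i j ¬h↗ , trans (above-no i j ¬h↗) (indicator-no (InD? la (suc i) j) ¬h↑)
    where
    ¬h↗ : ¬ InD la (suc i) (suc j)
    ¬h↗ = ¬h↑ ∘ InD-left i<j

-- The extremal tableau

letterOf : ℕ → ℕ → Letter
letterOf k zero    = unprimed k
letterOf k (suc _) = primed k

idx-letterOf : ∀ k v → idx (letterOf k v) ≡ k
idx-letterOf k zero    = refl
idx-letterOf k (suc v) = refl

primeBit-letterOf : ∀ k v → v ≤ 1 → primeBit (letterOf k v) ≡ v
primeBit-letterOf k zero       _ = refl
primeBit-letterOf k (suc zero) _ = refl
primeBit-letterOf k (2+ v) (s≤s ())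

upCode-letterOf : ∀ k v → v ≤ 1 → upCode (letterOf k v) ≡ 2 * k + 2 * (1 ∸ v)
upCode-letterOf k zero       _ = +-comm 2 (2 * k)
upCode-letterOf k (suc zero) _ = sym (+-identityʳ (2 * k))
upCode-letterOf k (2+ v) (s≤s ())

next : Letter → Letter
next (primed k)   = unprimed k
next (unprimed k) = primed (suc k)

code-next : ∀ x → code (next x) ≡ suc (code x)
code-next (primed k)   = refl
code-next (unprimed k) = 2*[1+n] k

code-injective : ∀ x y → code x ≡ code y → x ≡ y
code-injective (primed a)   (primed b)   e = cong primed (*-cancelˡ-≡ a b 2 e)
code-injective (unprimed a) (unprimed b) e = cong unprimed (*-cancelˡ-≡ a b 2 (suc-injective e))
code-injective (primed a)   (unprimed b) e = ⊥-elim (even≢odd a b e)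
code-injective (unprimed a) (primed b)   e = ⊥-elim (even≢odd b a (sym e))

codeRun : Letter → ℕ → List Letter
codeRun x zero    = []
codeRun x (suc k) = x ∷ codeRun (next x) k

length-codeRun : ∀ x k → length (codeRun x k) ≡ k
length-codeRun x zero    = refl
length-codeRun x (suc k) = cong suc (length-codeRun (next x) k)

code-maxOf-codeRun : ∀ x k → code (maxOf (codeRun x (suc k))) ≡ code x + k
code-maxOf-codeRun x zero    = sym (+-identityʳ (code x))
code-maxOf-codeRun x (suc k) = trans (code-maxOf-codeRun (next x) k) (trans (cong (_+ k) (code-next x)) (sym (+-suc (code x) k)))

codeRun-increasing : ∀ x k → Linked _<L_ (codeRun x k)
codeRun-increasing x zero          = []
codeRun-increasing x (suc zero)    = [-]
codeRun-increasing x (suc (suc k)) = ≤-reflexive (sym (code-next x)) ∷ codeRun-increasing (next x) (suc k)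

codeRun-range : ∀ x k → All (λ z → code x ≤ code z × code z ≤ code x + k) (codeRun x (suc k))
codeRun-range x zero    = (≤-refl , ≤-reflexive (sym (+-identityʳ _))) ∷ []
codeRun-range x (suc k) = (≤-refl , m≤m+n _ _) ∷ widen (codeRun-range (next x) k)
  where
  widen : ∀ {S} → All (λ z → code (next x) ≤ code z × code z ≤ code (next x) + k) S →
          All (λ z → code x ≤ code z × code z ≤ code x + suc k) S
  widen []                    = []
  widen {z ∷ S} ((lo , hi) ∷ r) =
    (≤-trans (n≤1+n _) (subst (_≤ code z) (code-next x) lo) ,
     subst (code z ≤_) (trans (cong (_+ k) (code-next x)) (sym (+-suc (code x) k))) hi) ∷ widen r

unprimedRun : ℕ → ℕ → List Letter
unprimedRun i zero    = []
unprimedRun i (suc k) = unprimed i ∷ unprimedRun (suc i) k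

length-unprimedRun : ∀ i k → length (unprimedRun i k) ≡ k
length-unprimedRun i zero    = refl
length-unprimedRun i (suc k) = cong suc (length-unprimedRun (suc i) k)

maxOf-unprimedRun : ∀ i k → maxOf (unprimedRun i (suc k)) ≡ unprimed (i + k)
maxOf-unprimedRun i zero    = cong unprimed (sym (+-identityʳ i))
maxOf-unprimedRun i (suc k) = trans (maxOf-unprimedRun (suc i) k) (cong unprimed (sym (+-suc i k)))

unprimedRun-increasing : ∀ i k → Linked _<L_ (unprimedRun i k)
unprimedRun-increasing i zero          = []
unprimedRun-increasing i (suc zero)    = [-]
unprimedRun-increasing i (suc (suc k)) = s≤s (≤-trans (n≤1+n _) (≤-reflexive (sym (2*[1+n] i)))) ∷ unprimedRun-increasing (suc i) (suc k)

unprimedRun-unprimed : ∀ i k → All (λ z → isPrimed z ≡ false) (unprimedRun i k)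
unprimedRun-unprimed i zero    = []
unprimedRun-unprimed i (suc k) = refl ∷ unprimedRun-unprimed (suc i) k

unprimedRun-range : ∀ i k → All (λ z → i ≤ idx z × idx z ≤ i + k) (unprimedRun i (suc k))
unprimedRun-range i zero    = (≤-refl , ≤-reflexive (sym (+-identityʳ i))) ∷ []
unprimedRun-range i (suc k) = (≤-refl , m≤m+n i (suc k)) ∷ widen (unprimedRun-range (suc i) k)
  where
  widen : ∀ {S} → All (λ z → suc i ≤ idx z × idx z ≤ suc i + k) S → All (λ z → i ≤ idx z × idx z ≤ i + suc k) S
  widen []                    = []
  widen {z ∷ S} ((lo , hi) ∷ r) = (≤-trans (n≤1+n i) lo , subst (idx z ≤_) (sym (+-suc i k)) hi) ∷ widen r

module Extremal (la : List ℕ) (sp : StrictPartition la) (Δ : List ℕ) (isL : IsLargestDPartitionIn Δ la)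
                (n : ℕ) (L≤n : length la ≤ n) where

  open LargestDPartition la sp Δ isL
  open DiagonalRuns la sp

  i+κ+above≤n : ∀ i j → InD la i j → i + κ i j + above i j ≤ n
  i+κ+above≤n i j h = ≤-trans (i+κ+above≤L i j h) L≤n

  κ≤n : ∀ i j → InD la i j → κ i j ≤ n
  κ≤n i j h = ≤-trans (≤-trans (m≤n+m (κ i j) i) (m≤m+n (i + κ i j) (above i j))) (i+κ+above≤n i j h)

  i≤n∸κ : ∀ i j → InD la i j → i ≤ n ∸ κ i j
  i≤n∸κ i j h = m+n≤o⇒m≤o∸n i (≤-trans (m≤m+n (i + κ i j) (above i j)) (i+κ+above≤n i j h))

  outerLetter : ℕ → ℕ → Letter
  outerLetter i j = letterOf (n ∸ κ i j) (above i j)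

  idx-outerLetter : ∀ i j → idx (outerLetter i j) ≡ n ∸ κ i j
  idx-outerLetter i j = idx-letterOf (n ∸ κ i j) (above i j)

  primeBit-outerLetter : ∀ i j → primeBit (outerLetter i j) ≡ above i j
  primeBit-outerLetter i j = primeBit-letterOf (n ∸ κ i j) (above i j) (above≤1 i j)

  code-outerLetter : ∀ i j → code (outerLetter i j) + above i j ≡ suc (2 * (n ∸ κ i j))
  code-outerLetter i j = trans (cong (code (outerLetter i j) +_) (sym (primeBit-outerLetter i j)))
    (trans (code+primeBit (outerLetter i j)) (cong (λ t → suc (2 * t)) (idx-outerLetter i j)))

  1+2i≤code-outerLetter : ∀ i j → InD la i j → suc (i + i) ≤ code (outerLetter i j)
  1+2i≤code-outerLetter i j h = +-cancelʳ-≤ v (suc (i + i)) (code (outerLetter i j)) (begin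
    suc (i + i) + v       ≤⟨ s≤s (m≤m+n (i + i + v) v) ⟩
    suc (i + i + v + v)   ≡⟨ e₁ i v ⟩
    suc (2 * (i + v))     ≤⟨ s≤s (*-monoʳ-≤ 2 i+v≤) ⟩
    suc (2 * (n ∸ κ i j)) ≡⟨ code-outerLetter i j ⟨
    code (outerLetter i j) + v ∎)
    where
    open ≤-Reasoning
    v = above i j
    e₁ : ∀ i v → suc (i + i + v + v) ≡ suc (2 * (i + v))
    e₁ = solve-∀
    e₂ : ∀ i v k → i + v + k ≡ i + k + v
    e₂ = solve-∀
    i+v≤ : i + v ≤ n ∸ κ i j
    i+v≤ = m+n≤o⇒m≤o∸n (i + v) (≤-trans (≤-reflexive (e₂ i v (κ i j))) (i+κ+above≤n i j h))

  codeSpan : ℕ → ℕ → ℕ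
  codeSpan i j = code (outerLetter i j) ∸ suc (i + i)

  lastΔFilling : ℕ → ℕ → Filling
  lastΔFilling i j with i ≟ j
  ... | yes _ = unprimedRun i (suc (n ∸ κ i i ∸ i))
  ... | no _  = codeRun (unprimed i) (suc (codeSpan i j))

  data Position (i j : ℕ) : Set where
    inner : suc j < i + δ i → Position i j
    lastΔ : suc j ≡ i + δ i → Position i j
    outer : i + δ i ≤ j     → Position i j

  position : ∀ i j → Position i j
  position i j with <-cmp (suc j) (i + δ i)
  ... | tri< a _ _ = inner a
  ... | tri≈ _ b _ = lastΔ b
  ... | tri> _ _ c = outer (≤-pred c)

  extremal : ℕ → ℕ → Filling
  extremal i j with position i j
  ... | inner _ = unprimed i ∷ []
  ... | lastΔ _ = lastΔFilling i j
  ... | outer _ = outerLetter i j ∷ []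

  extremal-inner : ∀ {i j} → suc j < i + δ i → extremal i j ≡ unprimed i ∷ []
  extremal-inner {i} {j} h with position i j
  ... | inner _ = refl
  ... | lastΔ e = ⊥-elim (<-irrefl e h)
  ... | outer o = ⊥-elim (<-asym h (s≤s o))

  extremal-outer : ∀ {i j} → i + δ i ≤ j → extremal i j ≡ outerLetter i j ∷ []
  extremal-outer {i} {j} h with position i j
  ... | inner i< = ⊥-elim (<-asym i< (s≤s h))
  ... | lastΔ e  = ⊥-elim (<-irrefl (sym e) (s≤s h))
  ... | outer _  = refl

  extremal-lastΔ-diag : ∀ {i} → suc i ≡ i + δ i → extremal i i ≡ unprimedRun i (suc (n ∸ κ i i ∸ i))
  extremal-lastΔ-diag {i} e with position i i
  ... | inner i< = ⊥-elim (<-irrefl e i<)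
  ... | outer o  = ⊥-elim (<-irrefl (sym e) (s≤s o))
  ... | lastΔ _ with i ≟ i
  ...   | yes _ = refl
  ...   | no ne = ⊥-elim (ne refl)

  extremal-lastΔ-offDiag : ∀ {i j} → suc j ≡ i + δ i → i ≢ j → extremal i j ≡ codeRun (unprimed i) (suc (codeSpan i j))
  extremal-lastΔ-offDiag {i} {j} e i≢j with position i j
  ... | inner i< = ⊥-elim (<-irrefl e i<)
  ... | outer o  = ⊥-elim (<-irrefl (sym e) (s≤s o))
  ... | lastΔ _ with i ≟ j
  ...   | yes i≡j = ⊥-elim (i≢j i≡j)
  ...   | no _    = refl

  code-unprimed+codeSpan : ∀ i j → InD la i j → code (unprimed i) + codeSpan i j ≡ code (outerLetter i j)
  code-unprimed+codeSpan i j h = trans (cong (λ t → suc (i + t) + codeSpan i j) (+-identityʳ i))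
                                   (m+[n∸m]≡n (1+2i≤code-outerLetter i j h))

  maxOf-lastΔ-offDiag : ∀ i j → InD la i j → maxOf (codeRun (unprimed i) (suc (codeSpan i j))) ≡ outerLetter i j
  maxOf-lastΔ-offDiag i j h = code-injective _ _
    (trans (code-maxOf-codeRun (unprimed i) (codeSpan i j)) (code-unprimed+codeSpan i j h))

  maxOf-lastΔ-diag : ∀ i → InD la i i → maxOf (unprimedRun i (suc (n ∸ κ i i ∸ i))) ≡ outerLetter i i
  maxOf-lastΔ-diag i h = trans (maxOf-unprimedRun i _)
    (trans (cong unprimed (m+[n∸m]≡n (i≤n∸κ i i h))) (cong (letterOf (n ∸ κ i i)) (sym (above-diag≡0 i))))

  last-extremal-tail : ∀ i j → InD la i j → i + δ i ≤ suc j → last (extremal i j) ≡ just (outerLetter i j)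
  last-extremal-tail i j h tail with position i j
  ... | inner i< = ⊥-elim (<⇒≱ i< tail)
  ... | outer _  = refl
  ... | lastΔ _ with i ≟ j
  ...   | yes refl = trans (last≡maxOf (unprimedRun i (suc (n ∸ κ i i ∸ i))) (λ ())) (cong just (maxOf-lastΔ-diag i h))
  ...   | no _     = trans (last≡maxOf (codeRun (unprimed i) (suc (codeSpan i j))) (λ ())) (cong just (maxOf-lastΔ-offDiag i j h))

  head-extremal-Δ : ∀ i j → suc j ≤ i + δ i → head (extremal i j) ≡ just (unprimed i)
  head-extremal-Δ i j inΔ with position i j
  ... | inner _ = refl
  ... | outer o = ⊥-elim (<⇒≱ (s≤s o) inΔ)
  ... | lastΔ _ with i ≟ j
  ...   | yes refl = refl
  ...   | no _     = refl

  private
    2*[N∸K]≤code : ∀ N K c v → v ≤ 1 → c + v ≡ suc (2 * (N ∸ K)) → 2 * (N ∸ K) ≤ c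
    2*[N∸K]≤code N K c v v≤1 c+v≡ = +-cancelʳ-≤ v _ _ (≤-trans (+-monoʳ-≤ (2 * (N ∸ K)) v≤1)
                                      (≤-reflexive (trans (+-comm _ 1) (sym c+v≡))))

  upCode-outerLetter≤ : ∀ i j → 1 ≤ i → InD la (suc i) j → upCode (outerLetter i j) ≤ code (outerLetter (suc i) j)
  upCode-outerLetter≤ i j i≥1 h↑ = begin
    upCode (outerLetter i j)                       ≡⟨ upCode-letterOf (n ∸ κ i j) (above i j) (above≤1 i j) ⟩
    2 * (n ∸ κ i j) + 2 * (1 ∸ above i j)          ≡⟨ cong₂ (λ a b → 2 * (n ∸ a) + 2 * b) κ≡ 1∸above≡ ⟩
    2 * (n ∸ (κ′ + ρ)) + 2 * ρ                     ≡⟨ *-distribˡ-+ 2 (n ∸ (κ′ + ρ)) ρ ⟨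
    2 * (n ∸ (κ′ + ρ) + ρ)                         ≡⟨ cong (2 *_) (trans (cong (_+ ρ) (sym (∸-+-assoc n κ′ ρ))) (m∸n+n≡m ρ≤)) ⟩
    2 * (n ∸ κ′)                                   ≤⟨ 2*[N∸K]≤code n κ′ _ (above (suc i) j) (above≤1 (suc i) j) (code-outerLetter (suc i) j) ⟩
    code (outerLetter (suc i) j)                   ∎
    where
    open ≤-Reasoning
    κ′ = κ (suc i) j
    ρ = beside (suc i) j
    κ≡ : κ i j ≡ κ′ + ρ
    κ≡ = κ-step-up i j h↑
    1∸above≡ : 1 ∸ above i j ≡ ρ
    1∸above≡ = trans (cong (_∸ above i j) (sym (above+beside≡1 i j h↑))) (m+n∸m≡n (above i j) ρ)
    ρ≤ : ρ ≤ n ∸ κ′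
    ρ≤ = m+n≤o⇒m≤o∸n ρ (subst (_≤ n) (trans κ≡ (+-comm κ′ ρ)) (κ≤n i j (InD-below i≥1 h↑)))

  1+2*idx-outerLetter≤ : ∀ i j → InD la i (suc j) → i ≤ j → suc (2 * idx (outerLetter i j)) ≤ code (outerLetter i (suc j))
  1+2*idx-outerLetter≤ i j h→ i≤j = subst (λ t → suc (2 * t) ≤ code (outerLetter i (suc j)))
    (sym (trans (idx-outerLetter i j) (cong (n ∸_) (κ-step-right i j h→ i≤j))))
    (step (κ i (suc j)) (above i (suc j)) (above≤1 i (suc j)) K+v≤n (code-outerLetter i (suc j)))
    where
    K+v≤n : κ i (suc j) + above i (suc j) ≤ n
    K+v≤n = ≤-trans (m≤n+m _ i) (≤-trans (≤-reflexive (sym (+-assoc i _ _))) (i+κ+above≤n i (suc j) h→))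
    step : ∀ K v → v ≤ 1 → K + v ≤ n → ∀ {c} → c + v ≡ suc (2 * (n ∸ K)) → suc (2 * (n ∸ (K + v))) ≤ c
    step K zero       _ _ {c} c≡ = ≤-reflexive (trans (cong (λ t → suc (2 * (n ∸ t))) (+-identityʳ K)) (sym (trans (sym (+-identityʳ c)) c≡)))
    step K (suc zero) _ K+1≤n {c} c≡ = ≤-trans (n≤1+n _) (≤-reflexive (trans (sym (2*[1+n] (n ∸ (K + 1)))) (trans (cong (2 *_) 1+M≡) (sym c≡′))))
      where
      1+M≡ : suc (n ∸ (K + 1)) ≡ n ∸ K
      1+M≡ = trans (cong suc (sym (∸-+-assoc n K 1))) (trans (+-comm 1 _) (m∸n+n≡m (m+n≤o⇒m≤o∸n 1 (subst (_≤ n) (+-comm K 1) K+1≤n))))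
      c≡′ : c ≡ 2 * (n ∸ K)
      c≡′ = suc-injective (trans (+-comm 1 c) c≡)
    step K (2+ v) (s≤s ()) _ _

  extremal-valid : ∀ i j → InD la i j → ValidSet n (extremal i j)
  extremal-valid i j h with position i j
  ... | inner _ = (λ ()) , [-] , ((proj₁ h , ≤-trans (InD-row≤L h) L≤n) ∷ [])
  ... | outer _ = (λ ()) , [-] , ((1≤idx , idx≤n) ∷ [])
    where
    1≤idx : 1 ≤ idx (outerLetter i j)
    1≤idx = subst (1 ≤_) (sym (idx-outerLetter i j)) (≤-trans (proj₁ h) (i≤n∸κ i j h))
    idx≤n : idx (outerLetter i j) ≤ n
    idx≤n = subst (_≤ n) (sym (idx-outerLetter i j)) (m∸n≤m n (κ i j))
  ... | lastΔ _ with i ≟ j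
  ...   | yes refl = (λ ()) , unprimedRun-increasing i _ , All-map (λ {z} → inAlphabet {z}) (unprimedRun-range i (n ∸ κ i i ∸ i))
    where
    inAlphabet : ∀ {z} → i ≤ idx z × idx z ≤ i + (n ∸ κ i i ∸ i) → 1 ≤ idx z × idx z ≤ n
    inAlphabet (lo , hi) = ≤-trans (proj₁ h) lo , ≤-trans hi (≤-trans (≤-reflexive (m+[n∸m]≡n (i≤n∸κ i i h))) (m∸n≤m n (κ i i)))
  ...   | no _     = (λ ()) , codeRun-increasing (unprimed i) _ , All-map (λ {z} → inAlphabet {z}) (codeRun-range (unprimed i) (codeSpan i j))
    where
    inAlphabet : ∀ {z} → code (unprimed i) ≤ code z × code z ≤ code (unprimed i) + codeSpan i j → 1 ≤ idx z × idx z ≤ n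
    inAlphabet {z} (lo , hi) = ≤-trans (proj₁ h) (*-cancelˡ-≤ 2 (≤-pred (≤-trans lo (code≤1+2*idx z)))) ,
      2*m≤1+2*n⇒m≤n (idx z) n (≤-trans (2*idx≤code z) (≤-trans hi (≤-trans (≤-reflexive (code-unprimed+codeSpan i j h))
        (≤-trans (m≤m+n _ (above i j)) (≤-trans (≤-reflexive (code-outerLetter i j)) (s≤s (*-monoʳ-≤ 2 (m∸n≤m n (κ i j)))))))))

  extremal-upOK : ∀ i j → InD la i j → InD la (suc i) j → UpOK (last (extremal i j)) (head (extremal (suc i) j))
  extremal-upOK i j h h↑ with suc j <? i + δ i
  ... | yes j<
    rewrite cong last (extremal-inner j<)
          | head-extremal-Δ (suc i) j (≮⇒≥ (λ o → inner-below⇒notOuter i j (proj₁ h) j< h↑ (≤-pred o))) =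
    upCode≤⇒UpOK (unprimed i) (unprimed (suc i)) (s≤s (≤-trans (n≤1+n _) (≤-reflexive (sym (2*[1+n] i)))))
  ... | no ¬inner
    rewrite last-extremal-tail i j h (≮⇒≥ ¬inner)
          | cong head (extremal-outer (tail-below⇒outer i j (proj₁ h) (≮⇒≥ ¬inner) h↑)) =
    upCode≤⇒UpOK (outerLetter i j) (outerLetter (suc i) j) (upCode-outerLetter≤ i j (proj₁ h) h↑)

  extremal-rightOK : ∀ i j → InD la i j → InD la i (suc j) → RightOK (last (extremal i j)) (head (extremal i (suc j)))
  extremal-rightOK i j h h→ with suc j <? i + δ i
  ... | yes j<
    rewrite cong last (extremal-inner j<) | head-extremal-Δ i (suc j) j< =
    1+2*idx≤⇒RightOK (unprimed i) (unprimed i) ≤-refl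
  ... | no ¬inner
    rewrite last-extremal-tail i j h (≮⇒≥ ¬inner) | cong head (extremal-outer {i} {suc j} (≮⇒≥ ¬inner)) =
    1+2*idx≤⇒RightOK (outerLetter i j) (outerLetter i (suc j)) (1+2*idx-outerLetter≤ i j h→ (proj₁ (proj₂ h)))

  extremal-diagonal : ∀ i → InD la i i → All (λ x → isPrimed x ≡ false) (extremal i i)
  extremal-diagonal i h with position i i
  ... | inner _ = refl ∷ []
  ... | outer _ = subst (λ v → isPrimed (letterOf (n ∸ κ i i) v) ≡ false) (sym (above-diag≡0 i)) refl ∷ []
  ... | lastΔ _ with i ≟ i
  ...   | yes _ = unprimedRun-unprimed i _
  ...   | no ne = ⊥-elim (ne refl)

  extremal-isPSVT : IsPSVT la n extremal
  extremal-isPSVT = extremal-valid , extremal-upOK , extremal-rightOK , extremal-diagonal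

  open Tableau n la sp extremal extremal-isPSVT

  greatest-tail : ∀ i j → InD la i j → i + δ i ≤ suc j → greatest i j ≡ outerLetter i j
  greatest-tail i j h tail = maxOf-last (extremal i j) (last-extremal-tail i j h tail)

  rightSlack-tail : ∀ i j → InD la i j → i + δ i ≤ suc j → rightSlack i j ≡ κ i j
  rightSlack-tail i j h tail = trans (cong (λ t → n ∸ idx t) (greatest-tail i j h tail))
    (trans (cong (n ∸_) (idx-outerLetter i j)) (m∸[m∸n]≡n (κ≤n i j h)))

  upSlack-tail : ∀ i j → InD la i j → i + δ i ≤ suc j → upSlack i j ≡ κ i j + above i j
  upSlack-tail i j h tail = cong₂ _+_ (rightSlack-tail i j h tail)
    (trans (cong primeBit (greatest-tail i j h tail)) (primeBit-outerLetter i j))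

  leastCode-Δ : ∀ i j → suc j ≤ i + δ i → leastCode i j ≡ suc (2 * i)
  leastCode-Δ i j inΔ = cong code (minOf-head (extremal i j) (head-extremal-Δ i j inΔ))

  entries-inner : ∀ i j → suc j < i + δ i → entries i j ≡ 1
  entries-inner i j j< = cong length (extremal-inner j<)

  entries-outer : ∀ i j → i + δ i ≤ j → entries i j ≡ 1
  entries-outer i j out = cong length (extremal-outer out)

  1+i≡i+δ : ∀ r → δ r ≡ 1 → suc r ≡ r + δ r
  1+i≡i+δ r δ≡1 = trans (+-comm 1 r) (cong (r +_) (sym δ≡1))

  lastΔ-offDiag-tight : ∀ r j → InD la r j → r ≢ j → suc j ≡ r + δ r → entries r j + slack r j + leastCode r j ≡ n + n + 2
  lastΔ-offDiag-tight r j h r≢j e = begin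
    entries r j + slack r j + leastCode r j              ≡⟨ cong₂ (λ a b → a + slack r j + b) entries≡ (leastCode-Δ r j (≤-reflexive e)) ⟩
    suc (codeSpan r j) + slack r j + suc (2 * r)         ≡⟨ cong (λ t → suc (codeSpan r j) + t + suc (2 * r)) (slackOf-offDiag rightSlack upSlack r≢j) ⟩
    suc (codeSpan r j) + FC + suc (2 * r)                ≡⟨ e₁ (codeSpan r j) FC (2 * r) ⟩
    FC + (code (unprimed r) + codeSpan r j) + 1          ≡⟨ cong (λ t → FC + t + 1) (code-unprimed+codeSpan r j h) ⟩
    FC + code (outerLetter r j) + 1                      ≡⟨ cong (λ t → FC + code t + 1) (greatest-tail r j h (≤-reflexive (sym e))) ⟨
    FC + code (greatest r j) + 1                         ≡⟨ cong (_+ 1) (slacks+code≡ h) ⟩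
    n + n + 1 + 1                                        ≡⟨ +-assoc (n + n) 1 1 ⟩
    n + n + 2                                            ∎
    where
    open ≡-Reasoning
    FC = rightSlack r j + upSlack r j
    entries≡ : entries r j ≡ suc (codeSpan r j)
    entries≡ = trans (cong length (extremal-lastΔ-offDiag e r≢j)) (length-codeRun (unprimed r) (suc (codeSpan r j)))
    e₁ : ∀ c q t → suc c + q + suc t ≡ q + (suc t + c) + 1
    e₁ = solve-∀

  lastΔ-diag-tight : ∀ r → InD la r r → δ r ≡ 1 → entries r r + slack r r + idx (least r r) ≡ n + 1
  lastΔ-diag-tight r h δ≡1 = begin
    entries r r + slack r r + idx (least r r)   ≡⟨ cong₂ (λ a b → a + slack r r + b) entries≡ least≡ ⟩
    suc m + slack r r + r                       ≡⟨ cong (λ t → suc m + t + r) (slackOf-diag rightSlack upSlack r) ⟩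
    suc m + rightSlack r r + r                  ≡⟨ e₁ m (rightSlack r r) r ⟩
    suc (m + r) + rightSlack r r                ≡⟨ cong (λ t → suc t + rightSlack r r) (m∸n+n≡m (i≤n∸κ r r h)) ⟩
    suc (n ∸ κ r r) + rightSlack r r            ≡⟨ cong (λ t → suc t + rightSlack r r) idx≡ ⟨
    suc (idx (greatest r r)) + rightSlack r r   ≡⟨ e₂ (idx (greatest r r)) (rightSlack r r) ⟩
    rightSlack r r + idx (greatest r r) + 1     ≡⟨ cong (_+ 1) (rightSlack+idx≡n h) ⟩
    n + 1                                       ∎
    where
    open ≡-Reasoning
    m = n ∸ κ r r ∸ r
    filling≡ = extremal-lastΔ-diag (1+i≡i+δ r δ≡1)
    entries≡ : entries r r ≡ suc m
    entries≡ = trans (cong length filling≡) (length-unprimedRun r (suc m))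
    least≡ : idx (least r r) ≡ r
    least≡ = cong (idx ∘ minOf) filling≡
    idx≡ : idx (greatest r r) ≡ n ∸ κ r r
    idx≡ = trans (cong idx (greatest-tail r r h (≤-reflexive (sym (1+i≡i+δ r δ≡1))))) (idx-outerLetter r r)
    e₁ : ∀ m f r → suc m + f + r ≡ suc (m + r) + f
    e₁ = solve-∀
    e₂ : ∀ a f → suc a + f ≡ f + a + 1
    e₂ = solve-∀

  outer-offDiag-tight : ∀ i j → InD la (suc i) (suc j) → InD la (suc i) j → InD la i (suc j) → i ≢ j →
                        suc i + δ (suc i) ≤ suc j →
                        entries (suc i) (suc j) + slack (suc i) (suc j) ≡ rightSlack (suc i) j + upSlack i (suc j)
  outer-offDiag-tight i j hC h← h↓ i≢j out = begin
    entries C₁ C₂ + slack C₁ C₂               ≡⟨ cong₂ _+_ (entries-outer C₁ C₂ out)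
                                                   (trans (slackOf-offDiag rightSlack upSlack (i≢j ∘ suc-injective))
                                                     (cong₂ _+_ (rightSlack-tail C₁ C₂ hC tail) (upSlack-tail C₁ C₂ hC tail))) ⟩
    1 + (κ′ + (κ′ + a′))                      ≡⟨ e₁ κ′ a′ ⟩
    (κ′ + a′) + (κ′ + 1)                      ≡⟨ cong₂ _+_ (trans (rightSlack-tail C₁ j h← out) (κ-step-right C₁ j hC i<j)) below≡ ⟨
    rightSlack C₁ j + upSlack i C₂            ∎
    where
    open ≡-Reasoning
    C₁ = suc i
    C₂ = suc j
    κ′ = κ C₁ C₂
    a′ = above C₁ C₂
    tail : C₁ + δ C₁ ≤ suc C₂
    tail = m≤n⇒m≤1+n out
    i<j : suc i ≤ j
    i<j = ≤-pred (≤∧≢⇒< (proj₁ (proj₂ hC)) (i≢j ∘ suc-injective))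
    e₁ : ∀ k v → 1 + (k + (k + v)) ≡ (k + v) + (k + 1)
    e₁ = solve-∀
    below≡ : upSlack i C₂ ≡ κ′ + 1
    below≡ = begin
      upSlack i C₂                          ≡⟨ upSlack-tail i C₂ h↓ (outer⇒tail-below i C₂ (proj₁ h↓) hC out) ⟩
      κ i C₂ + above i C₂                   ≡⟨ cong (_+ above i C₂) (κ-step-up i C₂ hC) ⟩
      κ′ + beside C₁ C₂ + above i C₂        ≡⟨ +-assoc κ′ (beside C₁ C₂) (above i C₂) ⟩
      κ′ + (beside C₁ C₂ + above i C₂)      ≡⟨ cong (κ′ +_) (trans (+-comm (beside C₁ C₂) (above i C₂)) (above+beside≡1 i C₂ hC)) ⟩
      κ′ + 1                                ∎

  outer-diag-tight : ∀ i → InD la (suc i) (suc i) → InD la i (suc i) → δ (suc i) ≡ 0 →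
                     entries (suc i) (suc i) + slack (suc i) (suc i) ≡ upSlack i (suc i)
  outer-diag-tight i hC h↓ δ≡0 = begin
    entries C C + slack C C        ≡⟨ cong₂ _+_ (entries-outer C C out) (trans (slackOf-diag rightSlack upSlack C) (rightSlack-tail C C hC (m≤n⇒m≤1+n out))) ⟩
    1 + κ C C                      ≡⟨ +-comm 1 (κ C C) ⟩
    κ C C + 1                      ≡⟨ cong (κ C C +_) (above+beside≡1 i C hC) ⟨
    κ C C + (above i C + beside C C) ≡⟨ cong (κ C C +_) (+-comm (above i C) (beside C C)) ⟩
    κ C C + (beside C C + above i C) ≡⟨ +-assoc (κ C C) (beside C C) (above i C) ⟨
    κ C C + beside C C + above i C ≡⟨ cong (_+ above i C) (κ-step-up i C hC) ⟨
    κ i C + above i C              ≡⟨ upSlack-tail i C h↓ (outer⇒tail-below i C (proj₁ h↓) hC out) ⟨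
    upSlack i C                    ∎
    where
    open ≡-Reasoning
    C = suc i
    out : C + δ C ≤ C
    out = ≤-reflexive (trans (cong (C +_) δ≡0) (+-identityʳ C))

  rightSlack-rowEnd≡0 : ∀ r → 1 ≤ r → r ≤ length la → rightSlack r (r + lam r ∸ 1) ≡ 0
  rightSlack-rowEnd≡0 (suc r′) _ r≤L = trans (rightSlack-tail r e h tail) (κ-rowEnd r e h (λ h→ → <-irrefl e+1≡ (proj₂ (proj₂ h→))))
    where
    r = suc r′
    lam≥1 : 1 ≤ lam r
    lam≥1 = lam-pos r′ r≤L
    e = r + lam r ∸ 1
    e+1≡ : suc e ≡ r + lam r
    e+1≡ = m+[n∸m]≡n {1} (≤-trans lam≥1 (m≤n+m (lam r) r))
    h : InD la r e
    h = s≤s z≤n , ≤-pred (≤-trans (≤-reflexive (+-comm 1 r)) (≤-trans (+-monoʳ-≤ r lam≥1) (≤-reflexive (sym e+1≡)))) , ≤-reflexive e+1≡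
    tail : r + δ r ≤ suc e
    tail = ≤-trans (+-monoʳ-≤ r (δ≤lam r)) (≤-reflexive (sym e+1≡))

  upSlack-unused≡0 : ∀ r j → 1 ≤ r → r ≤ length la → InRange (tailStart Δ r) (tailLength la Δ r) j →
                     ¬ InRange (outerStart Δ (suc r)) (outerLength la Δ (suc r)) j → offDiagonal r j (upSlack r j) ≡ 0
  upSlack-unused≡0 r j r≥1 r≤L (a≤j , j<) ¬outer with r ≟ j
  ... | yes _   = refl
  ... | no r≢j = trans (upSlack-tail r j h tail) (cong₂ _+_ (proj₁ noUp) (proj₂ noUp))
    where
    r≤j : r ≤ j
    r≤j = ≤-trans (m≤m+n r (δ r ∸ 1)) a≤j
    h : InD la r j
    h = r≥1 , r≤j , subst (j <_) (tailStart+tailLength r) j<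
    tail : r + δ r ≤ suc j
    tail = ≤-trans (+-monoʳ-≤ r (m≤n+m∸n (δ r) 1)) (≤-trans (≤-reflexive (+-suc r (δ r ∸ 1))) (s≤s a≤j))
    noUp : κ r j ≡ 0 × above r j ≡ 0
    noUp = κ,above-noUp r j (≤∧≢⇒< r≤j r≢j) (λ h↑ → ¬outer
      (tail-below⇒outer r j r≥1 tail h↑ ,
       subst (j <_) (sym (outerStart+outerLength (suc r))) (proj₂ (proj₂ h↑))))

  tightBounds : LocalBounds ≡-additivePreorder la Δ n
  tightBounds = record
    { entries           = entries
    ; rightSlack        = rightSlack
    ; upSlack           = upSlack
    ; least             = least
    ; inΔ-step          = λ r j h h→ j+1< → trans (cong₂ _+_ (entries-inner r j j+1<) (leastCode-Δ r j (<⇒≤ j+1<)))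
                                               (trans (+-comm 1 _) (cong (_+ 1) (sym (leastCode-Δ r (suc j) j+1<))))
    ; lastΔ-offDiag     = λ r j h r≢j e → lastΔ-offDiag-tight r j h r≢j e
    ; lastΔ-diag        = λ r h δ≡1 → lastΔ-diag-tight r h δ≡1
    ; firstΔ-leastCode  = λ r h δ≥2 → sym (trans (leastCode-Δ r r (≤-trans (≤-reflexive (+-comm 1 r)) (+-monoʳ-≤ r (<⇒≤ δ≥2))))
                                             (cong (λ t → suc (r + t)) (+-identityʳ r)))
    ; firstΔ-leastIdx   = λ r h δ≡1 → sym (cong (idx ∘ minOf) (extremal-lastΔ-diag (1+i≡i+δ r δ≡1)))
    ; outer-offDiag     = outer-offDiag-tight
    ; outer-diag        = outer-diag-tight
    ; rightSlack-rowEnd = λ r r≥1 r≤L → sym (rightSlack-rowEnd≡0 r r≥1 r≤L)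
    ; upSlack-unused    = λ r j r≥1 r≤L j∈ ¬outer → sym (upSlack-unused≡0 r j r≥1 r≤L j∈ ¬outer)
    }

  degT-extremal : degT la extremal ≡ sumRange (λ r → rowBound n r (part Δ r)) 1 (length la)
  degT-extremal = trans (degT≡sumRange la extremal)
                    (SlackArgument.entries≲rowBounds la sp Δ isL n L≤n ≡-additivePreorder tightBounds)

theorem1p1 : (la : List ℕ) (n : ℕ) → StrictPartition la → ¬ (la ≡ []) → 1 ≤ n
    → len la ≤ n → (Δ : List ℕ) → IsLargestDPartitionIn Δ la
    → HasDegree la n (degFormula n Δ)
theorem1p1 la n sp la≢[] _ L≤n Δ isL = upper , extremal , extremal-isPSVT , attained
  where
  open Extremal la sp Δ isL n L≤n using (extremal; extremal-isPSVT; degT-extremal)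
  open RowBoundSum la sp Δ isL n L≤n (1≤length la la≢[]) using (sumRange-b≡degFormula)

  upper : ∀ T → IsPSVT la n T → ℤ.+ degT la T ℤ.≤ degFormula n Δ
  upper T isT = subst (ℤ.+ degT la T ℤ.≤_) sumRange-b≡degFormula
                  (ℤ.+≤+ (UpperBound.degT≤ la sp Δ isL n L≤n T isT))

  attained : ℤ.+ degT la extremal ≡ degFormula n Δ
  attained = trans (cong ℤ.+_ degT-extremal) sumRange-b≡degFormula
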